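{- Two triangulations $T_1,T_2\in\mathcal{T}_n$ differ by a diagonal flip if and only if there exist a reading $w_1$ of $T_1$ and a reading $w_2$ of $T_2$ such that $w_1=uxzv$ and $w_2=uzxv$, where $x,z\in X$ and $u,v$ are words such that $v$ contains no letter $y\in X$ satisfying $x<y<z$ or $z<y<x$.
   Context: $X=\{x_1<\dots<x_n\}$ is a set of positive integers, $\widehat{X}=X\cup\{0,\infty\}$ with $0<x_1<\dots<x_n<\infty$, $P$ is a convex $(n+2)$-gon with vertices labelled by $\widehat{X}$ in clockwise increasing order, and $\mathcal{T}_n$ is the set of triangulations of $P$ ($n-1$ noncrossing diagonals cutting $P$ into $n$ triangles). Permutations in $S_n$ are words using each letter of $X$ once; for $\sigma=x_{i_1}\cdots x_{i_n}$, $\varphi(\sigma)$ is the triangulation whose diagonals are, for $k=1,\dots,n-1$, the segments joining the predecessor and successor of $x_{i_k}$ in $\widehat{X}\setminus\{x_{i_1},\dots,x_{i_{k-1}}\}$. A reading of $T\in\mathcal{T}_n$ is a permutation $\sigma$ with $\varphi(\sigma)=T$. A diagonal flip replaces a diagonal $d$ by the other diagonal of the quadrilateral formed by the two faces adjacent to $d$. -}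

module Defs where

open import Data.Nat using (ℕ; zero; suc; _<_; _∸_; _⊔_; _<ᵇ_)
open import Data.Bool using (if_then_else_)
open import Data.List using (List; []; _∷_; length; foldr; _++_)
open import Data.List.Membership.Propositional using (_∈_)
open import Data.List.Relation.Unary.All using (All)
open import Data.List.Relation.Unary.Linked using (Linked)
open import Data.List.Relation.Unary.Unique.Propositional using (Unique)
open import Data.List.Relation.Binary.Permutation.Propositional using (_↭_)
open import Data.Product using (Σ; ∃; _×_; _,_)
open import Data.Sum using (_⊎_)
open import Function.Bundles using (_⇔_)
open import Relation.Binary.PropositionalEquality using (_≡_; _≢_)
open import Relation.Nullary using (¬_)

-- Vertex labels of the polygon P: natural numbers (0 and the x_i) and ∞.
data V : Set where
  fin : ℕ → V
  ∞   : V

data _<V_ : V → V → Set where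
  fin<fin : ∀ {m n} → m < n → fin m <V fin n
  fin<∞   : ∀ {m} → fin m <V ∞

ValidX : List ℕ → Set
ValidX X = Linked _<_ X × All (λ x → 0 < x) X

InHat : List ℕ → V → Set
InHat X v = (v ≡ fin 0) ⊎ (v ≡ ∞) ⊎ (Σ ℕ λ x → x ∈ X × v ≡ fin x)

-- A segment joining two vertices, stored as (smaller , larger).
Seg : Set
Seg = V × V

-- Boundary edge of P: two cyclically consecutive vertices of X̂.
PolyEdge : List ℕ → V → V → Set
PolyEdge X a b =
  (InHat X a × InHat X b × a <V b × (∀ c → InHat X c → a <V c → ¬ (c <V b)))
  ⊎ (a ≡ fin 0 × b ≡ ∞)

IsDiagonal : List ℕ → Seg → Set
IsDiagonal X (a , b) = InHat X a × InHat X b × a <V b × ¬ PolyEdge X a b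

Cross : Seg → Seg → Set
Cross (a , b) (c , d) = (a <V c × c <V b × b <V d) ⊎ (c <V a × a <V d × d <V b)

record IsTriangulation (X : List ℕ) (T : List Seg) : Set where
  field
    diags       : All (IsDiagonal X) T
    distinct    : Unique T
    size        : length T ≡ length X ∸ 1
    noncrossing : ∀ d e → d ∈ T → e ∈ T → ¬ Cross d e

_≈ₛ_ : List Seg → List Seg → Set
T ≈ₛ T' = ∀ d → d ∈ T ⇔ d ∈ T'

predIn : ℕ → List ℕ → ℕ
predIn x R = foldr (λ y m → if y <ᵇ x then y ⊔ m else m) 0 R

minV : V → V → V
minV (fin a) (fin b) = if a <ᵇ b then fin a else fin b
minV (fin a) ∞ = fin a
minV ∞ w = w

succIn : ℕ → List ℕ → V
succIn x R = foldr (λ y v → if x <ᵇ y then minV (fin y) v else v) ∞ R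

-- φ(σ): for k = 1..n-1, the segment joining predecessor and successor of the
-- k-th letter in X̂ ∖ {first k-1 letters}; the remaining letters of X are
-- exactly those of the suffix of σ after the k-th letter.
φ : List ℕ → List Seg
φ []          = []
φ (x ∷ [])    = []
φ (x ∷ y ∷ w) = (fin (predIn x (y ∷ w)) , succIn x (y ∷ w)) ∷ φ (y ∷ w)

Reading : List ℕ → List Seg → List ℕ → Set
Reading X T σ = (σ ↭ X) × (φ σ ≈ₛ T)

Side : List ℕ → List Seg → V → V → Set
Side X T p q = PolyEdge X p q ⊎ (p , q) ∈ T

Face : List ℕ → List Seg → V → V → V → Set
Face X T p q r = Side X T p q × Side X T q r × Side X T p r

Replace : List Seg → List Seg → Seg → Seg → Set
Replace T₁ T₂ d d' = d ∈ T₁ × (∀ e → e ∈ T₂ ⇔ (e ≡ d' ⊎ (e ∈ T₁ × e ≢ d)))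

DifferByFlip : List ℕ → List Seg → List Seg → Set
DifferByFlip X T₁ T₂ =
  Σ V λ p → Σ V λ q → Σ V λ r → Σ V λ s →
    InHat X p × InHat X q × InHat X r × InHat X s ×
    p <V q × q <V r × r <V s ×
    ((Face X T₁ p q r × Face X T₁ p r s × Replace T₁ T₂ (p , r) (q , s))
     ⊎ (Face X T₁ p q s × Face X T₁ q r s × Replace T₁ T₂ (q , s) (p , r)))

Between : ℕ → ℕ → ℕ → Set
Between x z y = (x < y × y < z) ⊎ (z < y × y < x)

{-# OPTIONS --safe #-}
-- Removing a letter c whose neighbours in X̂ are joined by a diagonal of T (an ear) leaves a
-- triangulation of X ∖ c, and c followed by a reading of that triangulation is a reading of T.
-- Every diagonal has an ear inside it: together with the outer edge, the diagonals are a full,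
-- hence maximal, noncrossing family of intervals of vertex positions, and an innermost member
-- of such a family spans a single vertex. So readings exist.
--
-- If no letter of v lies between x < z, the words u x z v and u z x v give the same segments,
-- except that (pred_v x , z) is replaced by (x , succ_v z): the two diagonals of the
-- quadrilateral pred_v x < x < z < succ_v z, whose sides are segments of φ(u x z v) or edges of
-- the polygon. Conversely, to flip the diagonal (p , r) of p < q < r < s into (q , s), remove
-- ears strictly between consecutive corners until p, q, r, s are consecutive. Then q is an ear,
-- and after removing it r is an ear or the last letter, which gives a reading u q r v; the
-- word u r q v reads the flipped triangulation. Flips of the other orientation follow by symmetry.
module Submission where

open import Defs
open import Data.Bool using (true; false)
open import Data.Empty using (⊥-elim)
open import Data.List using (List; []; _∷_; length; filter; _++_; map)
open import Data.List.Membership.Propositional using (_∈_; _∉_; find; lose)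
open import Data.List.Membership.Propositional.Properties
  using (∈-filter⁻; ∈-map⁺; ∈-map⁻; ∈-++⁺ˡ; ∈-++⁺ʳ; ∈-++⁻; ∈-insert)
open import Data.List.Properties using (length-map; ++-assoc)
open import Data.List.Relation.Binary.Permutation.Propositional
  using (_↭_; ↭-refl; ↭-prep; ↭-swap; ↭-trans; ↭-sym; ↭⇒↭ₛ)
open import Data.List.Relation.Binary.Permutation.Propositional.Properties
  using (↭-length; ∈-resp-↭; All-resp-↭; ++⁺ˡ; shift)
open import Data.List.Relation.Unary.All using (All; []; _∷_; lookup; tabulate)
import Data.List.Relation.Unary.All as All
open import Data.List.Relation.Unary.All.Properties using (All¬⇒¬Any; all-filter)
open import Data.List.Relation.Unary.AllPairs using (_∷_; [])
import Data.List.Relation.Unary.AllPairs as AllPairs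
open import Data.List.Relation.Unary.Any using (here; there; any?)
open import Data.List.Relation.Unary.Linked.Properties using (Linked⇒AllPairs)
open import Data.List.Relation.Unary.Unique.Propositional using (Unique)
import Data.List.Relation.Unary.Unique.Propositional.Properties as Unique
open import Data.Nat using (ℕ; suc; _+_; _≤_; _<_; z≤n; s≤s; _≤?_; _<?_; _≟_; _∸_; _<ᵇ_)
open import Data.Nat.Induction using (<-wellFounded)
open import Data.Nat.Properties
open import Data.Product using (Σ; ∃; _×_; _,_; proj₁; proj₂)
open import Data.Product.Properties using (≡-dec)
open import Data.Sum using (_⊎_; inj₁; inj₂; [_,_]′)
open import Function.Base using (_∘_)
open import Function.Bundles using (_⇔_; mk⇔; Equivalence)
open import Induction.WellFounded using (Acc; acc)
open import Relation.Binary.Consequences using (tri⇒dec≈; tri⇒dec<)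
open import Relation.Binary.Definitions using (DecidableEquality; Trichotomous; tri<; tri≈; tri>)
open import Relation.Binary.PropositionalEquality
  using (_≡_; _≢_; refl; sym; trans; cong; cong₂; subst; setoid; module ≡-Reasoning)
open import Relation.Nullary using (¬_; Dec; yes; no)
open import Relation.Nullary.Decidable using (_×-dec_; ¬?; decidable-stable)
open import Relation.Nullary.Reflects using (ofʸ; ofⁿ)
open import Relation.Unary using (Decidable)

module Deletion {A : Set} (_≟ᴬ_ : DecidableEquality A) where

  delete : A → List A → List A
  delete x [] = []
  delete x (y ∷ ys) with y ≟ᴬ x
  ... | yes _ = delete x ys
  ... | no  _ = y ∷ delete x ys

  delete-⊆ : ∀ {x y} ys → y ∈ delete x ys → y ∈ ys
  delete-⊆ {x} (z ∷ ys) m with z ≟ᴬ x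
  delete-⊆ (z ∷ ys) m         | yes _ = there (delete-⊆ ys m)
  delete-⊆ (z ∷ ys) (here e)  | no  _ = here e
  delete-⊆ (z ∷ ys) (there m) | no  _ = there (delete-⊆ ys m)

  delete-≢ : ∀ {x y} ys → y ∈ delete x ys → y ≢ x
  delete-≢ {x} (z ∷ ys) m with z ≟ᴬ x
  delete-≢ (z ∷ ys) m            | yes _  = delete-≢ ys m
  delete-≢ (z ∷ ys) (here refl)  | no z≢x = z≢x
  delete-≢ (z ∷ ys) (there m)    | no  _  = delete-≢ ys m

  ∈-delete⁺ : ∀ {x y ys} → y ∈ ys → y ≢ x → y ∈ delete x ys
  ∈-delete⁺ {x} {ys = z ∷ ys} m y≢x with z ≟ᴬ x
  ∈-delete⁺ (here refl) y≢x | yes z≡x = ⊥-elim (y≢x z≡x)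
  ∈-delete⁺ (there m)   y≢x | yes _   = ∈-delete⁺ m y≢x
  ∈-delete⁺ (here refl) y≢x | no  _   = here refl
  ∈-delete⁺ (there m)   y≢x | no  _   = there (∈-delete⁺ m y≢x)

  delete-unique : ∀ {x} ys → Unique ys → Unique (delete x ys)
  delete-unique [] _ = []
  delete-unique {x} (z ∷ ys) (z∉ys ∷ u) with z ≟ᴬ x
  ... | yes _ = delete-unique ys u
  ... | no  _ = tabulate (λ m → lookup z∉ys (delete-⊆ ys m)) ∷ delete-unique ys u

  delete-id : ∀ {x ys} → All (x ≢_) ys → delete x ys ≡ ys
  delete-id [] = refl
  delete-id {x} {z ∷ ys} (x≢z ∷ ps) with z ≟ᴬ x
  ... | yes z≡x = ⊥-elim (x≢z (sym z≡x))
  ... | no  _   = cong (z ∷_) (delete-id ps)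

  delete-↭ : ∀ {x} ys → Unique ys → x ∈ ys → ys ↭ x ∷ delete x ys
  delete-↭ {x} (z ∷ ys) (z∉ys ∷ u) m with z ≟ᴬ x
  delete-↭ (z ∷ ys) (z∉ys ∷ u) m         | yes refl = ↭-prep z (subst (ys ↭_) (sym (delete-id z∉ys)) ↭-refl)
  delete-↭ (z ∷ ys) (z∉ys ∷ u) (here e)  | no z≢x   = ⊥-elim (z≢x (sym e))
  delete-↭ (z ∷ ys) (z∉ys ∷ u) (there m) | no _     = ↭-trans (↭-prep z (delete-↭ ys u m)) (↭-swap z _ ↭-refl)

  length-delete : ∀ {x} ys → Unique ys → x ∈ ys → length ys ≡ suc (length (delete x ys))
  length-delete ys u m = ↭-length (delete-↭ ys u m)

  length-delete-≤ : ∀ {x} ys → Unique ys → length ys ≤ suc (length (delete x ys))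
  length-delete-≤ [] _ = z≤n
  length-delete-≤ {x} (z ∷ ys) (z∉ys ∷ u) with z ≟ᴬ x
  ... | yes refl = s≤s (≤-reflexive (cong length (sym (delete-id z∉ys))))
  ... | no  _    = s≤s (length-delete-≤ ys u)

open Deletion

∈⇒0<length : ∀ {A : Set} {x : A} {L} → x ∈ L → 0 < length L
∈⇒0<length (here _)  = s≤s z≤n
∈⇒0<length (there _) = s≤s z≤n

unique-resp-↭ : ∀ {A : Set} {xs ys : List A} → xs ↭ ys → Unique xs → Unique ys
unique-resp-↭ {A} p = Unique-resp-↭ (↭⇒↭ₛ p)
  where open import Data.List.Relation.Binary.Permutation.Setoid.Properties (setoid A) using (Unique-resp-↭)

unique-++⁻ʳ : ∀ {A : Set} (u : List A) {w} → Unique (u ++ w) → Unique w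
unique-++⁻ʳ []      uniq       = uniq
unique-++⁻ʳ (_ ∷ u) (_ ∷ uniq) = unique-++⁻ʳ u uniq

unique-∷∷ : ∀ {A : Set} {a b : A} {v} → Unique (a ∷ b ∷ v) → a ∉ v × b ∉ v
unique-∷∷ ((_ ∷ a∉v) ∷ b∉v ∷ _) = All¬⇒¬Any a∉v , All¬⇒¬Any b∉v

unique-singleton : ∀ {A : Set} {L : List A} {z} → Unique L → z ∈ L → (∀ {y} → y ∈ L → y ≡ z) → L ≡ z ∷ []
unique-singleton {L = a ∷ []}    _                _ only = cong (_∷ []) (only (here refl))
unique-singleton {L = a ∷ b ∷ _} ((a≢b ∷ _) ∷ _) _ only =
  ⊥-elim (a≢b (trans (only (here refl)) (sym (only (there (here refl))))))

length-filter-⊎ : ∀ {A : Set} {P Q : A → Set} (P? : Decidable P) (Q? : Decidable Q) {L} →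
                  All (λ x → P x ⊎ Q x) L → length L ≤ length (filter P? L) + length (filter Q? L)
length-filter-⊎ P? Q? [] = z≤n
length-filter-⊎ P? Q? {x ∷ L} (pq ∷ pqs) with P? x | Q? x | length-filter-⊎ P? Q? pqs
... | yes _ | yes _ | ih = s≤s (≤-trans ih (+-monoʳ-≤ (length (filter P? L)) (n≤1+n _)))
... | yes _ | no  _ | ih = s≤s ih
... | no  _ | yes _ | ih = ≤-trans (s≤s ih) (≤-reflexive (sym (+-suc _ _)))
... | no ¬p | no ¬q | _ with pq
...   | inj₁ p = ⊥-elim (¬p p)
...   | inj₂ q = ⊥-elim (¬q q)

<V-trans : ∀ {a b c} → a <V b → b <V c → a <V c
<V-trans (fin<fin p) (fin<fin q) = fin<fin (<-trans p q)
<V-trans (fin<fin p) fin<∞       = fin<∞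

<V-irrefl : ∀ {a} → ¬ a <V a
<V-irrefl (fin<fin p) = <-irrefl refl p

<V-asym : ∀ {a b} → a <V b → ¬ b <V a
<V-asym p q = <V-irrefl (<V-trans p q)

<V⇒≢ : ∀ {a b} → a <V b → a ≢ b
<V⇒≢ p refl = <V-irrefl p

>V⇒≢ : ∀ {a b} → a <V b → b ≢ a
>V⇒≢ p refl = <V-irrefl p

≮V0 : ∀ {a} → ¬ a <V fin 0
≮V0 (fin<fin ())

∞≮V : ∀ {a} → ¬ ∞ <V a
∞≮V ()

fin-injective : ∀ {m n} → fin m ≡ fin n → m ≡ n
fin-injective refl = refl

fin<fin⁻ : ∀ {m n} → fin m <V fin n → m < n
fin<fin⁻ (fin<fin p) = p

<V-cmp : Trichotomous _≡_ _<V_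
<V-cmp (fin m) (fin n) with <-cmp m n
... | tri< m<n _ _ = tri< (fin<fin m<n) (<V⇒≢ (fin<fin m<n)) (<V-asym (fin<fin m<n))
... | tri≈ _ refl _ = tri≈ <V-irrefl refl <V-irrefl
... | tri> _ _ n<m = tri> (<V-asym (fin<fin n<m)) (>V⇒≢ (fin<fin n<m)) (fin<fin n<m)
<V-cmp (fin m) ∞ = tri< fin<∞ (λ ()) ∞≮V
<V-cmp ∞ (fin n) = tri> ∞≮V (λ ()) fin<∞
<V-cmp ∞ ∞ = tri≈ ∞≮V refl ∞≮V

_<V?_ : ∀ a b → Dec (a <V b)
_<V?_ = tri⇒dec< <V-cmp

_≟V_ : DecidableEquality V
_≟V_ = tri⇒dec≈ <V-cmp

_≟S_ : DecidableEquality Seg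
_≟S_ = ≡-dec _≟V_ _≟V_

<V⇒<V∞ : ∀ {a b} → a <V b → a <V ∞
<V⇒<V∞ (fin<fin _) = fin<∞
<V⇒<V∞ fin<∞       = fin<∞

InHat-mono : ∀ {L L' v} → (∀ {y} → y ∈ L → y ∈ L') → InHat L v → InHat L' v
InHat-mono f (inj₁ e)                  = inj₁ e
InHat-mono f (inj₂ (inj₁ e))           = inj₂ (inj₁ e)
InHat-mono f (inj₂ (inj₂ (x , m , e))) = inj₂ (inj₂ (x , f m , e))

InHat-0 : ∀ {L} → InHat L (fin 0)
InHat-0 = inj₁ refl

InHat-∞ : ∀ {L} → InHat L ∞
InHat-∞ = inj₂ (inj₁ refl)

∈⇒InHat : ∀ {L y} → y ∈ L → InHat L (fin y)
∈⇒InHat m = inj₂ (inj₂ (_ , m , refl))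

InHat-fin⇒∈ : ∀ {L y} → InHat L (fin y) → y ∈ 0 ∷ L
InHat-fin⇒∈ (inj₁ refl)                  = here refl
InHat-fin⇒∈ (inj₂ (inj₂ (_ , m , refl))) = there m

InHat⇒∈ : ∀ {L a y} → InHat L (fin y) → a <V fin y → y ∈ L
InHat⇒∈ (inj₁ refl)                  ay = ⊥-elim (≮V0 ay)
InHat⇒∈ (inj₂ (inj₂ (_ , m , refl))) _  = m

LetterBetween : List ℕ → V → V → Set
LetterBetween L a b = ∃ λ y → y ∈ L × a <V fin y × fin y <V b

letterBetween? : ∀ L a b → Dec (LetterBetween L a b)
letterBetween? L a b with any? (λ y → (a <V? fin y) ×-dec (fin y <V? b)) L
... | yes p = yes (find p)
... | no ¬p = no λ (y , m , ay , yb) → ¬p (lose m (ay , yb))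

Consecutive : List ℕ → V → V → Set
Consecutive L a b = InHat L a × InHat L b × a <V b × (∀ c → InHat L c → a <V c → ¬ c <V b)

InHat⇒letterBetween : ∀ {L a w b} → InHat L w → a <V w → w <V b → LetterBetween L a b
InHat⇒letterBetween (inj₁ refl)                  aw _  = ⊥-elim (≮V0 aw)
InHat⇒letterBetween (inj₂ (inj₁ refl))           _  wb = ⊥-elim (∞≮V wb)
InHat⇒letterBetween (inj₂ (inj₂ (y , m , refl))) aw wb = y , m , aw , wb

consecutive : ∀ {L a b} → InHat L a → InHat L b → a <V b → ¬ LetterBetween L a b → Consecutive L a b
consecutive ha hb ab none = ha , hb , ab , λ c hc ac cb → none (InHat⇒letterBetween hc ac cb)

consecutive⇒¬between : ∀ {L a b} → Consecutive L a b → ¬ LetterBetween L a b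
consecutive⇒¬between (_ , _ , _ , gap) (y , m , ay , yb) = gap (fin y) (∈⇒InHat m) ay yb

Consecutive-⊆ : ∀ {L L' a b} → (∀ {y} → y ∈ L' → y ∈ L) → InHat L' a → InHat L' b →
                Consecutive L a b → Consecutive L' a b
Consecutive-⊆ f ha hb (_ , _ , ab , gap) = ha , hb , ab , λ c hc → gap c (InHat-mono f hc)

nonEdge⇒letterBetween : ∀ {L a b} → InHat L a → InHat L b → a <V b → ¬ PolyEdge L a b → LetterBetween L a b
nonEdge⇒letterBetween {L} {a} {b} ha hb ab ¬edge with letterBetween? L a b
... | yes between = between
... | no  none    = ⊥-elim (¬edge (inj₁ (consecutive ha hb ab none)))

letterBetween⇒nonEdge : ∀ {L a b} → LetterBetween L a b → ¬ (a ≡ fin 0 × b ≡ ∞) → ¬ PolyEdge L a b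
letterBetween⇒nonEdge between _     (inj₁ cons)  = consecutive⇒¬between cons between
letterBetween⇒nonEdge _       outer (inj₂ 0-∞)   = outer 0-∞

between-consecutive : ∀ {L a m b w} → Consecutive L a m → Consecutive L m b → InHat L w → a <V w → w <V b → w ≡ m
between-consecutive {m = m} {w = w} am mb hw aw wb with <V-cmp w m
... | tri< wm _ _ = ⊥-elim (consecutive⇒¬between am (InHat⇒letterBetween hw aw wm))
... | tri≈ _ e _  = e
... | tri> _ _ mw = ⊥-elim (consecutive⇒¬between mb (InHat⇒letterBetween hw mw wb))

Consecutive-split : ∀ {L a b c} → Consecutive L a b → a <V fin c → fin c <V b →
                    Consecutive (c ∷ L) a (fin c) × Consecutive (c ∷ L) (fin c) b
Consecutive-split cons@(ha , hb , _) ac cb =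
  consecutive (InHat-mono there ha) (∈⇒InHat (here refl)) ac left ,
  consecutive (∈⇒InHat (here refl)) (InHat-mono there hb) cb right
  where
  left : ¬ LetterBetween _ _ _
  left (_ , here refl , _ , cc)  = <V-irrefl cc
  left (y , there m , ay , yc)   = consecutive⇒¬between cons (y , m , ay , <V-trans yc cb)
  right : ¬ LetterBetween _ _ _
  right (_ , here refl , cc , _) = <V-irrefl cc
  right (y , there m , cy , yb)  = consecutive⇒¬between cons (y , m , <V-trans ac cy , yb)

Consecutive-[] : ∀ {a b} → Consecutive [] a b → a ≡ fin 0 × b ≡ ∞
Consecutive-[] (inj₁ refl         , inj₂ (inj₁ refl) , _ , _) = refl , refl
Consecutive-[] (inj₁ refl         , inj₁ refl        , ab , _) = ⊥-elim (≮V0 ab)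
Consecutive-[] (inj₂ (inj₁ refl)  , _                , ab , _) = ⊥-elim (∞≮V ab)
Consecutive-[] (inj₂ (inj₂ (_ , () , _)) , _ , _ , _)
Consecutive-[] (_ , inj₂ (inj₂ (_ , () , _)) , _ , _)

Consecutive-↭ : ∀ {L L' a b} → L ↭ L' → Consecutive L a b → Consecutive L' a b
Consecutive-↭ p cons@(ha , hb , _) =
  Consecutive-⊆ (∈-resp-↭ (↭-sym p)) (InHat-mono (∈-resp-↭ p) ha) (InHat-mono (∈-resp-↭ p) hb) cons

Consecutive-∷ : ∀ {L a b c} → Consecutive L a b → ¬ (a <V fin c × fin c <V b) → Consecutive (c ∷ L) a b
Consecutive-∷ cons@(ha , hb , ab , _) c∉ab = consecutive (InHat-mono there ha) (InHat-mono there hb) ab none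
  where
  none : ¬ LetterBetween _ _ _
  none (_ , here refl , ac , cb) = c∉ab (ac , cb)
  none (y , there m , ay , yb)   = consecutive⇒¬between cons (y , m , ay , yb)

-- Predecessors and successors

predIn-spec : ∀ c L → predIn c L ≡ 0 ⊎ (predIn c L ∈ L × predIn c L < c)
predIn-spec c [] = inj₁ refl
predIn-spec c (z ∷ L) with z <ᵇ c | <ᵇ-reflects-< z c | predIn-spec c L
... | false | _ | inj₁ e = inj₁ e
... | false | _ | inj₂ (m , lt) = inj₂ (there m , lt)
... | true | ofʸ z<c | spec with ⊔-sel z (predIn c L)
...   | inj₁ e rewrite e = inj₂ (here refl , z<c)
...   | inj₂ e rewrite e with spec
...     | inj₁ e₀ = inj₁ e₀
...     | inj₂ (m , lt) = inj₂ (there m , lt)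

predIn-maximal : ∀ {c y} L → y ∈ L → y < c → y ≤ predIn c L
predIn-maximal {c} (z ∷ L) m y<c with z <ᵇ c | <ᵇ-reflects-< z c | m
... | true  | _        | here refl = m≤m⊔n _ _
... | true  | _        | there m'  = ≤-trans (predIn-maximal L m' y<c) (m≤n⊔m z _)
... | false | ofⁿ z≮c  | here refl = ⊥-elim (z≮c y<c)
... | false | _        | there m'  = predIn-maximal L m' y<c

predIn-InHat : ∀ c L → InHat L (fin (predIn c L))
predIn-InHat c L with predIn-spec c L
... | inj₁ e       = inj₁ (cong fin e)
... | inj₂ (m , _) = ∈⇒InHat m

predIn-< : ∀ {c} L → 0 < c → predIn c L < c
predIn-< {c} L 0<c with predIn-spec c L
... | inj₁ e        = subst (_< c) (sym e) 0<c
... | inj₂ (_ , lt) = lt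

predIn-≤ : ∀ {c c'} L L' → (∀ {y} → y ∈ L → y < c → y ∈ L' × y < c') → predIn c L ≤ predIn c' L'
predIn-≤ {c} L L' f with predIn-spec c L
... | inj₁ e        = subst (_≤ _) (sym e) z≤n
... | inj₂ (m , lt) = let m' , lt' = f m lt in predIn-maximal L' m' lt'

predIn-cong : ∀ {c c'} L L' → (∀ {y} → y ∈ L → y < c → y ∈ L' × y < c') →
              (∀ {y} → y ∈ L' → y < c' → y ∈ L × y < c) → predIn c L ≡ predIn c' L'
predIn-cong L L' f g = ≤-antisym (predIn-≤ L L' f) (predIn-≤ L' L g)

predIn-gap : ∀ c L → ¬ LetterBetween L (fin (predIn c L)) (fin c)
predIn-gap c L (y , m , fin<fin p<y , fin<fin y<c) = <⇒≱ p<y (predIn-maximal L m y<c)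

predIn-≡ : ∀ {a c} L → InHat L (fin a) → a < c → ¬ LetterBetween L (fin a) (fin c) → predIn c L ≡ a
predIn-≡ {a} {c} L ha a<c gap with <-cmp (predIn c L) a
... | tri< p<a _ _ = ⊥-elim (predIn-gap c L (InHat⇒letterBetween ha (fin<fin p<a) (fin<fin a<c)))
... | tri≈ _ e _   = e
... | tri> _ _ a<p =
  ⊥-elim (gap (InHat⇒letterBetween (predIn-InHat c L) (fin<fin a<p) (fin<fin (predIn-< L (≤-<-trans z≤n a<c)))))

<V-minV⁻ : ∀ {w} a b → w <V minV a b → w <V a × w <V b
<V-minV⁻ (fin a) (fin b) w<min with a <ᵇ b | <ᵇ-reflects-< a b | w<min
... | true  | ofʸ a<b | w<a        = w<a , <V-trans w<a (fin<fin a<b)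
... | false | ofⁿ a≮b | fin<fin lt = fin<fin (<-≤-trans lt (≮⇒≥ a≮b)) , fin<fin lt
<V-minV⁻ (fin a) ∞ w<a = w<a , <V⇒<V∞ w<a
<V-minV⁻ ∞       b w<b = <V⇒<V∞ w<b , w<b

minV-sel : ∀ a b → minV a b ≡ a ⊎ minV a b ≡ b
minV-sel (fin a) (fin b) with a <ᵇ b
... | true  = inj₁ refl
... | false = inj₂ refl
minV-sel (fin a) ∞ = inj₁ refl
minV-sel ∞       b = inj₂ refl

succIn-spec : ∀ c L → InHat L (succIn c L) × fin c <V succIn c L
succIn-spec c [] = InHat-∞ , fin<∞
succIn-spec c (z ∷ L) with c <ᵇ z | <ᵇ-reflects-< c z | succIn-spec c L
... | false | _       | hs , cs = InHat-mono there hs , cs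
... | true  | ofʸ c<z | hs , cs with minV-sel (fin z) (succIn c L)
...   | inj₁ e rewrite e = ∈⇒InHat (here refl) , fin<fin c<z
...   | inj₂ e rewrite e = InHat-mono there hs , cs

succIn-InHat : ∀ c L → InHat L (succIn c L)
succIn-InHat c L = proj₁ (succIn-spec c L)

succIn-> : ∀ c L → fin c <V succIn c L
succIn-> c L = proj₂ (succIn-spec c L)

succIn-gap : ∀ c L → ¬ LetterBetween L (fin c) (succIn c L)
succIn-gap c (z ∷ L) (y , m , fin<fin c<y , y<s) with c <ᵇ z | <ᵇ-reflects-< c z | m
... | true  | _        | here refl = <V-irrefl (proj₁ (<V-minV⁻ (fin z) (succIn c L) y<s))
... | true  | _        | there m'  = succIn-gap c L (y , m' , fin<fin c<y , proj₂ (<V-minV⁻ (fin z) _ y<s))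
... | false | ofⁿ c≮z  | here refl = c≮z c<y
... | false | _        | there m'  = succIn-gap c L (y , m' , fin<fin c<y , y<s)

succIn-≡ : ∀ {b c} L → InHat L b → fin c <V b → ¬ LetterBetween L (fin c) b → succIn c L ≡ b
succIn-≡ {b} {c} L hb c<b gap with <V-cmp (succIn c L) b
... | tri< s<b _ _ = ⊥-elim (gap (InHat⇒letterBetween (succIn-InHat c L) (succIn-> c L) s<b))
... | tri≈ _ e _   = e
... | tri> _ _ b<s = ⊥-elim (succIn-gap c L (InHat⇒letterBetween hb c<b b<s))

LetterBetween-⊆ : ∀ {L L' c c' b} → (∀ {y} → y ∈ L → c < y → y ∈ L' × c' < y) →
                  LetterBetween L (fin c) b → LetterBetween L' (fin c') b
LetterBetween-⊆ f (y , m , c<y , y<b) = let m' , c'<y = f m (fin<fin⁻ c<y) in y , m' , fin<fin c'<y , y<b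

succIn-cong : ∀ {c c'} L L' → (∀ {y} → y ∈ L → c < y → y ∈ L' × c' < y) →
              (∀ {y} → y ∈ L' → c' < y → y ∈ L × c < y) → succIn c L ≡ succIn c' L'
succIn-cong {c} {c'} L L' f g with <V-cmp (succIn c L) (succIn c' L')
... | tri< s<s' _ _ = ⊥-elim (succIn-gap c' L' (LetterBetween-⊆ f (InHat⇒letterBetween (succIn-InHat c L) (succIn-> c L) s<s')))
... | tri≈ _ e _    = e
... | tri> _ _ s'<s = ⊥-elim (succIn-gap c L (LetterBetween-⊆ g (InHat⇒letterBetween (succIn-InHat c' L') (succIn-> c' L') s'<s)))

consecutive-pred : ∀ {c L} → 0 < c → c ∈ L → Consecutive L (fin (predIn c L)) (fin c)
consecutive-pred {c} {L} 0<c c∈L = consecutive (predIn-InHat c L) (∈⇒InHat c∈L) (fin<fin (predIn-< L 0<c)) (predIn-gap c L)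

consecutive-succ : ∀ {c L} → c ∈ L → Consecutive L (fin c) (succIn c L)
consecutive-succ {c} {L} c∈L = consecutive (∈⇒InHat c∈L) (succIn-InHat c L) (succIn-> c L) (succIn-gap c L)

-- The map φ

segAround : ℕ → List ℕ → Seg
segAround c L = fin (predIn c L) , succIn c L

segAround-cong : ∀ c L L' → (∀ {y} → y ≢ c → y ∈ L → y ∈ L') → (∀ {y} → y ≢ c → y ∈ L' → y ∈ L) →
                 segAround c L ≡ segAround c L'
segAround-cong c L L' f g =
  cong₂ _,_ (cong fin (predIn-cong {c} L L' (λ m lt → f (<⇒≢ lt) m , lt) (λ m lt → g (<⇒≢ lt) m , lt)))
            (succIn-cong {c} L L' (λ m lt → f (>⇒≢ lt) m , lt) (λ m lt → g (>⇒≢ lt) m , lt))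

segAround-≡ : ∀ {L a b c} → Consecutive L a b → a <V fin c → fin c <V b → segAround c L ≡ (a , b)
segAround-≡ {L} (ha , hb , _ , gap) (fin<fin a<c) c<b =
  cong₂ _,_ (cong fin (predIn-≡ L ha a<c λ (y , m , ay , yc) → gap (fin y) (∈⇒InHat m) ay (<V-trans yc c<b)))
            (succIn-≡ L hb c<b λ (y , m , cy , yb) → gap (fin y) (∈⇒InHat m) (<V-trans (fin<fin a<c) cy) yb)

segAround-∈ : ∀ {L a b c} → Consecutive L a (fin c) → Consecutive L (fin c) b → segAround c L ≡ (a , b)
segAround-∈ {L} ac@(ha , _ , fin<fin a<c , _) cb@(_ , hb , c<b , _) =
  cong₂ _,_ (cong fin (predIn-≡ L ha a<c (consecutive⇒¬between ac))) (succIn-≡ L hb c<b (consecutive⇒¬between cb))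

segAround-consecutive : ∀ {c L} → 0 < c → c ∉ L → Consecutive L (fin (predIn c L)) (succIn c L)
segAround-consecutive {c} {L} 0<c c∉L =
  consecutive (predIn-InHat c L) (succIn-InHat c L) (<V-trans (fin<fin (predIn-< L 0<c)) (succIn-> c L)) none
  where
  none : ¬ LetterBetween L (fin (predIn c L)) (succIn c L)
  none (y , m , py , ys) with <-cmp y c
  ... | tri< y<c _ _ = predIn-gap c L (y , m , py , fin<fin y<c)
  ... | tri≈ _ refl _ = c∉L m
  ... | tri> _ _ c<y = succIn-gap c L (y , m , fin<fin c<y , ys)

φ-∷ : ∀ y L → L ≢ [] → φ (y ∷ L) ≡ segAround y L ∷ φ L
φ-∷ y []      L≢[] = ⊥-elim (L≢[] refl)
φ-∷ y (_ ∷ _) _    = refl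

φPrefix : List ℕ → List ℕ → List Seg
φPrefix []      w = []
φPrefix (y ∷ u) w = segAround y (u ++ w) ∷ φPrefix u w

φ-++ : ∀ u w → w ≢ [] → φ (u ++ w) ≡ φPrefix u w ++ φ w
φ-++ []      w w≢[] = refl
φ-++ (y ∷ u) w w≢[] = trans (φ-∷ y (u ++ w) (++≢[] u)) (cong (segAround y (u ++ w) ∷_) (φ-++ u w w≢[]))
  where
  ++≢[] : ∀ u → u ++ w ≢ []
  ++≢[] []      = w≢[]
  ++≢[] (_ ∷ _) ()

φPrefix-cong : ∀ u w w' → (∀ {y} → y ∈ w → y ∈ w') → (∀ {y} → y ∈ w' → y ∈ w) → φPrefix u w ≡ φPrefix u w'
φPrefix-cong []      w w' f g = refl
φPrefix-cong (y ∷ u) w w' f g =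
  cong₂ _∷_ (segAround-cong y (u ++ w) (u ++ w') (λ _ → ++-⊆ f) (λ _ → ++-⊆ g)) (φPrefix-cong u w w' f g)
  where
  ++-⊆ : ∀ {w w'} → (∀ {y} → y ∈ w → y ∈ w') → ∀ {y} → y ∈ u ++ w → y ∈ u ++ w'
  ++-⊆ f m with ∈-++⁻ u m
  ... | inj₁ m' = ∈-++⁺ˡ m'
  ... | inj₂ m' = ∈-++⁺ʳ u (f m')

φ-letter-inside : ∀ σ → All (0 <_) σ → ∀ {a b} → (a , b) ∈ φ σ → LetterBetween σ a b
φ-letter-inside (y ∷ z ∷ t) (0<y ∷ _) (here refl) = y , here refl , fin<fin (predIn-< (z ∷ t) 0<y) , succIn-> y (z ∷ t)
φ-letter-inside (y ∷ z ∷ t) (_ ∷ pos) (there m) =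
  let x , m' , ax , xb = φ-letter-inside (z ∷ t) pos m in x , there m' , ax , xb

φ-unique : ∀ σ → Unique σ → All (0 <_) σ → Unique (φ σ)
φ-unique []          _                _          = []
φ-unique (y ∷ [])    _                _          = []
φ-unique (y ∷ z ∷ t) (y∉zt ∷ uniq) (0<y ∷ pos) = tabulate new ∷ φ-unique (z ∷ t) uniq pos
  where
  new : ∀ {d} → d ∈ φ (z ∷ t) → segAround y (z ∷ t) ≢ d
  new m refl = consecutive⇒¬between (segAround-consecutive 0<y (All¬⇒¬Any y∉zt)) (φ-letter-inside (z ∷ t) pos m)

consecutive-prefix : ∀ u {w a b} → Consecutive w a b → Consecutive (u ++ w) a b ⊎ (a , b) ∈ φPrefix u w
consecutive-prefix []      cons = inj₁ cons
consecutive-prefix (c ∷ u) {a = a} {b} cons with consecutive-prefix u cons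
... | inj₂ m = inj₂ (there m)
... | inj₁ cons' with (a <V? fin c) ×-dec (fin c <V? b)
...   | yes (ac , cb) = inj₂ (here (sym (segAround-≡ cons' ac cb)))
...   | no  c∉ab      = inj₁ (Consecutive-∷ cons' c∉ab)

reading-∈ : ∀ {X T σ d} → Reading X T σ → d ∈ φ σ → d ∈ T
reading-∈ (_ , φσ≈T) m = Equivalence.to (φσ≈T _) m

consecutive⇒side : ∀ {X T a b} u w → Reading X T (u ++ w) → Consecutive w a b → Side X T a b
consecutive⇒side u [] _ cons = inj₁ (inj₂ (Consecutive-[] cons))
consecutive⇒side u w@(_ ∷ _) rd@(perm , _) cons with consecutive-prefix u cons
... | inj₁ cons' = inj₁ (inj₁ (Consecutive-↭ perm cons'))
... | inj₂ m     = inj₂ (reading-∈ rd (subst (_ ∈_) (sym (φ-++ u w (λ ()))) (∈-++⁺ˡ m)))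

φ-head-cong : ∀ {a b} v → segAround a v ≡ segAround b v → φ (a ∷ v) ≡ φ (b ∷ v)
φ-head-cong []      _ = refl
φ-head-cong (y ∷ v) e = cong (_∷ φ (y ∷ v)) e

Outside : ℕ → ℕ → ℕ → Set
Outside a b y = y < a ⊎ b < y

module AdjacentSwap {a b v} (a<b : a < b) (outside : All (Outside a b) v) where

  private
    below : ∀ {y} → y ∈ v → y < b → y < a
    below m y<b with lookup outside m
    ... | inj₁ y<a = y<a
    ... | inj₂ b<y = ⊥-elim (<-asym y<b b<y)

    above : ∀ {y} → y ∈ v → a < y → b < y
    above m a<y with lookup outside m
    ... | inj₁ y<a = ⊥-elim (<-asym y<a a<y)
    ... | inj₂ b<y = b<y

    not-inside : ∀ {y} → y ∈ v → ¬ (a < y × y < b)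
    not-inside m (a<y , y<b) = <-asym a<y (below m y<b)

    a∉v : a ∉ v
    a∉v m with lookup outside m
    ... | inj₁ a<a = <-irrefl refl a<a
    ... | inj₂ b<a = <-asym a<b b<a

  segAround-swap : segAround a v ≡ segAround b v
  segAround-swap = cong₂ _,_
    (cong fin (predIn-cong v v (λ m lt → m , <-trans lt a<b) (λ m lt → m , below m lt)))
    (succIn-cong v v (λ m lt → m , above m lt) (λ m lt → m , <-trans a<b lt))

  segAround-ascent : segAround a (b ∷ v) ≡ (fin (predIn a v) , fin b)
  segAround-ascent = cong₂ _,_
    (cong fin (predIn-cong (b ∷ v) v skip-b (λ m lt → there m , lt)))
    (succIn-≡ (b ∷ v) (∈⇒InHat (here refl)) (fin<fin a<b) none)
    where
    skip-b : ∀ {y} → y ∈ b ∷ v → y < a → y ∈ v × y < a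
    skip-b (here refl) y<a = ⊥-elim (<-asym y<a a<b)
    skip-b (there m)   y<a = m , y<a
    none : ¬ LetterBetween (b ∷ v) (fin a) (fin b)
    none (_ , here refl , _   , b<b)        = <V-irrefl b<b
    none (_ , there m , fin<fin a<y , fin<fin y<b) = not-inside m (a<y , y<b)

  segAround-descent : segAround b (a ∷ v) ≡ (fin a , succIn b v)
  segAround-descent = cong₂ _,_
    (cong fin (predIn-≡ (a ∷ v) (∈⇒InHat (here refl)) a<b none))
    (succIn-cong (a ∷ v) v skip-a (λ m lt → there m , lt))
    where
    skip-a : ∀ {y} → y ∈ a ∷ v → b < y → y ∈ v × b < y
    skip-a (here refl) b<y = ⊥-elim (<-asym b<y a<b)
    skip-a (there m)   b<y = m , b<y
    none : ¬ LetterBetween (a ∷ v) (fin a) (fin b)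
    none (_ , here refl , a<a , _)                = <V-irrefl a<a
    none (_ , there m , fin<fin a<y , fin<fin y<b) = not-inside m (a<y , y<b)

  φ-ascent : ∀ u → φ (u ++ a ∷ b ∷ v) ≡ φPrefix u (a ∷ b ∷ v) ++ (fin (predIn a v) , fin b) ∷ φ (b ∷ v)
  φ-ascent u = begin
    φ (u ++ a ∷ b ∷ v)
      ≡⟨ φ-++ u (a ∷ b ∷ v) (λ ()) ⟩
    φPrefix u (a ∷ b ∷ v) ++ segAround a (b ∷ v) ∷ φ (b ∷ v)
      ≡⟨ cong (λ d → φPrefix u (a ∷ b ∷ v) ++ d ∷ φ (b ∷ v)) segAround-ascent ⟩
    φPrefix u (a ∷ b ∷ v) ++ (fin (predIn a v) , fin b) ∷ φ (b ∷ v)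
      ∎
    where open ≡-Reasoning

  φ-descent : ∀ u → φ (u ++ b ∷ a ∷ v) ≡ φPrefix u (a ∷ b ∷ v) ++ (fin a , succIn b v) ∷ φ (b ∷ v)
  φ-descent u = begin
    φ (u ++ b ∷ a ∷ v)
      ≡⟨ φ-++ u (b ∷ a ∷ v) (λ ()) ⟩
    φPrefix u (b ∷ a ∷ v) ++ segAround b (a ∷ v) ∷ φ (a ∷ v)
      ≡⟨ cong₂ (λ A d → A ++ d ∷ φ (a ∷ v)) (φPrefix-cong u _ _ swap-∈ swap-∈) segAround-descent ⟩
    φPrefix u (a ∷ b ∷ v) ++ (fin a , succIn b v) ∷ φ (a ∷ v)
      ≡⟨ cong (λ t → φPrefix u (a ∷ b ∷ v) ++ (fin a , succIn b v) ∷ t) (φ-head-cong v segAround-swap) ⟩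
    φPrefix u (a ∷ b ∷ v) ++ (fin a , succIn b v) ∷ φ (b ∷ v)
      ∎
    where
    open ≡-Reasoning
    swap-∈ : ∀ {x y z} → z ∈ x ∷ y ∷ v → z ∈ y ∷ x ∷ v
    swap-∈ (here e)         = there (here e)
    swap-∈ (there (here e)) = here e
    swap-∈ (there (there m)) = there (there m)

  ascent-faces : ∀ {X T} u → Reading X T (u ++ a ∷ b ∷ v) → 0 < a →
                 Face X T (fin (predIn a v)) (fin a) (fin b) × Face X T (fin (predIn a v)) (fin b) (succIn b v)
  ascent-faces {X} {T} u rd 0<a =
    (side u refl (proj₁ Pab) , side u refl (proj₂ Pab) , Pb) ,
    (Pb , side u refl bS , side (u ++ a ∷ b ∷ []) (sym (++-assoc u _ _)) PS)
    where
    P<a : fin (predIn a v) <V fin a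
    P<a = fin<fin (predIn-< v 0<a)
    PS : Consecutive v (fin (predIn a v)) (succIn b v)
    PS = subst (Consecutive v _) (cong proj₂ segAround-swap) (segAround-consecutive 0<a a∉v)
    PbS : Consecutive (b ∷ v) (fin (predIn a v)) (fin b) × Consecutive (b ∷ v) (fin b) (succIn b v)
    PbS = Consecutive-split PS (<V-trans P<a (fin<fin a<b)) (succIn-> b v)
    Pab : Consecutive (a ∷ b ∷ v) (fin (predIn a v)) (fin a) × Consecutive (a ∷ b ∷ v) (fin a) (fin b)
    Pab = Consecutive-split (proj₁ PbS) P<a (fin<fin a<b)
    bS : Consecutive (a ∷ b ∷ v) (fin b) (succIn b v)
    bS = Consecutive-∷ (proj₂ PbS) λ (ba , _) → <-asym a<b (fin<fin⁻ ba)
    side : ∀ {c d} u' {w} → u ++ a ∷ b ∷ v ≡ u' ++ w → Consecutive w c d → Side X T c d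
    side u' {w} e = consecutive⇒side u' w (subst (Reading X T) e rd)
    Pb : Side X T (fin (predIn a v)) (fin b)
    Pb = side (u ++ a ∷ []) (sym (++-assoc u _ _)) (proj₁ PbS)

-- Noncrossing families of intervals

Interval : Set
Interval = ℕ × ℕ

_≟I_ : DecidableEquality Interval
_≟I_ = ≡-dec _≟_ _≟_

_⊑_ : Interval → Interval → Set
(e , f) ⊑ (c , d) = c ≤ e × f ≤ d

_⊑?_ : ∀ x y → Dec (x ⊑ y)
(e , f) ⊑? (c , d) = (c ≤? e) ×-dec (f ≤? d)

⊑-trans : ∀ {x y z} → x ⊑ y → y ⊑ z → x ⊑ z
⊑-trans (c≤e , f≤d) (a≤c , d≤b) = ≤-trans a≤c c≤e , ≤-trans f≤d d≤b

-- Diagonals become intervals of vertex positions; 2 + c ≤ d excludes boundary edges.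
Within : ℕ → ℕ → Interval → Set
Within a b x@(c , d) = x ⊑ (a , b) × 2 + c ≤ d

within? : ∀ a b x → Dec (Within a b x)
within? a b x@(c , d) = (x ⊑? (a , b)) ×-dec (2 + c ≤? d)

Crossing : Interval → Interval → Set
Crossing (c , d) (e , f) = (c < e × e < d × d < f) ⊎ (e < c × c < f × f < d)

Crossing-sym : ∀ {x y} → Crossing x y → Crossing y x
Crossing-sym (inj₁ cr) = inj₂ cr
Crossing-sym (inj₂ cr) = inj₁ cr

Crossing-irrefl : ∀ {x} → ¬ Crossing x x
Crossing-irrefl (inj₁ (c<c , _)) = <-irrefl refl c<c
Crossing-irrefl (inj₂ (c<c , _)) = <-irrefl refl c<c

record Family (a b : ℕ) (S : List Interval) : Set where
  field
    within      : All (Within a b) S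
    unique      : Unique S
    noncrossing : ∀ {x y} → x ∈ S → y ∈ S → ¬ Crossing x y

module _ {a b S} (F : Family a b S) where
  open Family F

  Family-filter : ∀ c d → Family c d (filter (within? c d) S)
  Family-filter c d = record
    { within      = all-filter (within? c d) S
    ; unique      = Unique.filter⁺ (within? c d) unique
    ; noncrossing = λ mx my → noncrossing (⊆S mx) (⊆S my)
    }
    where
    ⊆S : ∀ {x} → x ∈ filter (within? c d) S → x ∈ S
    ⊆S m = proj₁ (∈-filter⁻ (within? c d) m)

  Family-delete : ∀ x → Family a b (delete _≟I_ x S)
  Family-delete x = record
    { within      = tabulate (λ m → lookup within (delete-⊆ _≟I_ S m))
    ; unique      = delete-unique _≟I_ S unique
    ; noncrossing = λ mx my → noncrossing (delete-⊆ _≟I_ S mx) (delete-⊆ _≟I_ S my)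
    }

  Family-∷ : ∀ {x} → Within a b x → x ∉ S → (∀ {y} → y ∈ S → ¬ Crossing x y) → Family a b (x ∷ S)
  Family-∷ {x} wx x∉S x⋈S = record
    { within      = wx ∷ within
    ; unique      = tabulate (λ m x≡y → x∉S (subst (_∈ S) (sym x≡y) m)) ∷ unique
    ; noncrossing = nc
    }
    where
    nc : ∀ {y z} → y ∈ x ∷ S → z ∈ x ∷ S → ¬ Crossing y z
    nc (here refl) (here refl) = Crossing-irrefl
    nc (here refl) (there mz)  = x⋈S mz
    nc (there my)  (here refl) = x⋈S my ∘ Crossing-sym
    nc (there my)  (there mz)  = noncrossing my mz

rightmost-from : ∀ a (S : List Interval) →
                 (∀ {d} → (a , d) ∉ S) ⊎ (∃ λ c → (a , c) ∈ S × ∀ {d} → (a , d) ∈ S → d ≤ c)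
rightmost-from a [] = inj₁ λ ()
rightmost-from a ((e , f) ∷ S) with e ≟ a | rightmost-from a S
... | no e≢a | inj₁ none = inj₁ λ { (here refl) → e≢a refl ; (there m) → none m }
... | no e≢a | inj₂ (c , m , max) = inj₂ (c , there m , λ { (here refl) → ⊥-elim (e≢a refl) ; (there m') → max m' })
... | yes refl | inj₁ none = inj₂ (f , here refl , λ { (here refl) → ≤-refl ; (there m') → ⊥-elim (none m') })
... | yes refl | inj₂ (c , m , max) with f ≤? c
...   | yes f≤c = inj₂ (c , there m , λ { (here refl) → f≤c ; (there m') → max m' })
...   | no  f≰c = inj₂ (f , here refl , λ { (here refl) → ≤-refl ; (there m') → ≤-trans (max m') (<⇒≤ (≰⇒> f≰c)) })

data Split (a b : ℕ) (S : List Interval) : Set where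
  cut  : ∀ {c S₁ S₂} → a < c → c < b → Family a c S₁ → Family c b S₂ →
         length S ≤ length S₁ + length S₂ → Split a b S
  skip : Family (suc a) b S → Split a b S

split : ∀ {a b S} → Family a b S → (a , b) ∉ S → Split a b S
split {a} {b} {S} F ab∉S with rightmost-from a S
... | inj₁ none = skip (record { within = tabulate shifted ; unique = unique ; noncrossing = noncrossing })
  where
  open Family F
  shifted : ∀ {x} → x ∈ S → Within (suc a) b x
  shifted {e , f} m with lookup within m
  ... | (a≤e , f≤b) , w = (≤∧≢⇒< a≤e (λ a≡e → none (subst (λ e → (e , f) ∈ S) (sym a≡e) m)) , f≤b) , w
... | inj₂ (c , ac∈S , max) = cut a<c c<b (Family-filter F a c) (Family-filter F c b)
                                (length-filter-⊎ (within? a c) (within? c b) (tabulate sides))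
  where
  open Family F
  c≤b : c ≤ b
  c≤b = proj₂ (proj₁ (lookup within ac∈S))
  a<c : a < c
  a<c = <⇒≤ (proj₂ (lookup within ac∈S))
  c<b : c < b
  c<b = ≤∧≢⇒< c≤b (λ c≡b → ab∉S (subst (λ c → (a , c) ∈ S) c≡b ac∈S))
  sides : ∀ {x} → x ∈ S → Within a c x ⊎ Within c b x
  sides {e , f} m with lookup within m
  ... | (a≤e , f≤b) , w with f ≤? c | c ≤? e
  ...   | yes f≤c | _       = inj₁ ((a≤e , f≤c) , w)
  ...   | no  _   | yes c≤e = inj₂ ((c≤e , f≤b) , w)
  ...   | no  f≰c | no  c≰e with e ≟ a
  ...     | yes refl = ⊥-elim (f≰c (max m))
  ...     | no  e≢a  = ⊥-elim (noncrossing ac∈S m (inj₁ (≤∧≢⇒< a≤e (e≢a ∘ sym) , ≰⇒> c≰e , ≰⇒> f≰c)))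

family-bound : ∀ {a b S} → a < b → Family a b S → a + length S < b
family-bound = go (<-wellFounded _)
  where
  go : ∀ {a b S} → Acc _<_ (b ∸ a) → a < b → Family a b S → a + length S < b
  go {a} {b} {[]}        _         a<b _ = subst (_< b) (sym (+-identityʳ a)) a<b
  go {a} {b} {S@(_ ∷ _)} (acc rec) a<b F with split (Family-delete F (a , b)) (λ m → delete-≢ _≟I_ S m refl)
  ... | cut {c} {S₁} {S₂} a<c c<b F₁ F₂ S⁻≤ = begin-strict
    a + length S                                ≤⟨ +-monoʳ-≤ a S≤ ⟩
    a + suc (length (delete _≟I_ (a , b) S))    ≤⟨ +-monoʳ-≤ a (s≤s S⁻≤) ⟩
    a + suc (length S₁ + length S₂)             ≡⟨ trans (+-suc a _) (cong suc (sym (+-assoc a _ _))) ⟩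
    suc (a + length S₁) + length S₂             ≤⟨ +-monoˡ-≤ (length S₂) (go (rec (∸-monoˡ-< c<b (<⇒≤ a<c))) a<c F₁) ⟩
    c + length S₂                               <⟨ go (rec (∸-monoʳ-< a<c (<⇒≤ c<b))) c<b F₂ ⟩
    b                                           ∎
    where
    open ≤-Reasoning
    S≤ : length S ≤ suc (length (delete _≟I_ (a , b) S))
    S≤ = length-delete-≤ _≟I_ S (Family.unique F)
  ... | skip F' = begin-strict
    a + length S                                ≤⟨ +-monoʳ-≤ a (length-delete-≤ _≟I_ S (Family.unique F)) ⟩
    a + suc (length (delete _≟I_ (a , b) S))    ≡⟨ +-suc a _ ⟩
    suc a + length (delete _≟I_ (a , b) S)      <⟨ go (rec (∸-monoʳ-< (n<1+n a) (<⇒≤ 1+a<b))) 1+a<b F' ⟩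
    b                                           ∎
    where
    open ≤-Reasoning
    1+a<b : suc a < b
    1+a<b with lookup (Family.within F) (here refl)
    ... | (a≤e , f≤b) , 2+e≤f = ≤-trans (s≤s (s≤s a≤e)) (≤-trans 2+e≤f f≤b)

width-⊏ : ∀ {e f c d} → e ≤ f → (e , f) ⊑ (c , d) → (e , f) ≢ (c , d) → f ∸ e < d ∸ c
width-⊏ {e} {f} {c} {d} e≤f (c≤e , f≤d) y≢x with m≤n⇒m<n∨m≡n c≤e
... | inj₁ c<e  = <-≤-trans (∸-monoʳ-< c<e e≤f) (∸-monoˡ-≤ c f≤d)
... | inj₂ refl = ∸-monoˡ-< (≤∧≢⇒< f≤d (λ f≡d → y≢x (cong (c ,_) f≡d))) e≤f

module _ {a b S} (F : Family a b S) where
  open Family F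

  family-maximal : b ≤ suc (a + length S) → ∀ {x} → Within a b x → x ∉ S → ¬ (∀ {y} → y ∈ S → ¬ Crossing x y)
  family-maximal full wx@((a≤c , d≤b) , 2+c≤d) x∉S x⋈S =
    <⇒≱ (family-bound a<b (Family-∷ F wx x∉S x⋈S)) (≤-trans full (≤-reflexive (sym (+-suc a _))))
    where
    a<b : a < b
    a<b = ≤-trans (s≤s a≤c) (≤-trans (<⇒≤ 2+c≤d) d≤b)

  family-innermost : ∀ {x} → x ∈ S → ∃ λ m → m ∈ S × m ⊑ x × (∀ {y} → y ∈ S → y ⊑ m → y ≡ m)
  family-innermost = go (<-wellFounded _)
    where
    go : ∀ {x} → Acc _<_ (proj₂ x ∸ proj₁ x) → x ∈ S →
         ∃ λ m → m ∈ S × m ⊑ x × (∀ {y} → y ∈ S → y ⊑ m → y ≡ m)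
    go {x} (acc rec) x∈S with any? (λ y → (y ⊑? x) ×-dec ¬? (y ≟I x)) S
    ... | no none = x , x∈S , (≤-refl , ≤-refl) ,
                    λ {y} y∈S y⊑x → decidable-stable (y ≟I x) (λ y≢x → none (lose y∈S (y⊑x , y≢x)))
    ... | yes inner with find inner
    ...   | y@(e , f) , y∈S , y⊑x , y≢x with go (rec (width-⊏ e≤f y⊑x y≢x)) y∈S
      where
      e≤f : e ≤ f
      e≤f = ≤-trans (m≤n+m e 2) (proj₂ (lookup within y∈S))
    ...     | m , m∈S , m⊑y , minimal = m , m∈S , ⊑-trans m⊑y y⊑x , minimal

  -- A full family is maximal, so an innermost member (c , d) with d > c + 2 could be
  -- refined by (c , c + 2).
  family-ear : b ≤ suc (a + length S) → ∀ {x} → x ∈ S → ∃ λ i → (i , 2 + i) ∈ S × (i , 2 + i) ⊑ x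
  family-ear full x∈S with family-innermost x∈S
  ... | (c , d) , m∈S , m⊑x , minimal with lookup within m∈S
  ...   | (a≤c , d≤b) , 2+c≤d with m≤n⇒m<n∨m≡n 2+c≤d
  ...     | inj₂ refl  = c , m∈S , m⊑x
  ...     | inj₁ 2+c<d = ⊥-elim (family-maximal full ((a≤c , ≤-trans (<⇒≤ 2+c<d) d≤b) , ≤-refl) ear∉S refines)
    where
    ear∉S : (c , 2 + c) ∉ S
    ear∉S e∈S = <-irrefl (cong proj₂ (minimal e∈S (≤-refl , <⇒≤ 2+c<d))) 2+c<d
    refines : ∀ {y} → y ∈ S → ¬ Crossing (c , 2 + c) y
    refines {g , h} y∈S (inj₁ (c<g , g<2+c , 2+c<h)) with h ≤? d
    ... | yes h≤d = <-irrefl (cong proj₁ (sym (minimal y∈S (<⇒≤ c<g , h≤d)))) c<g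
    ... | no  h≰d = noncrossing m∈S y∈S (inj₁ (c<g , <-trans g<2+c 2+c<d , ≰⇒> h≰d))
    refines {g , h} y∈S (inj₂ (g<c , c<h , h<2+c)) = noncrossing m∈S y∈S (inj₂ (g<c , c<h , <-trans h<2+c 2+c<d))

-- Ears

countBelow : ℕ → List ℕ → ℕ
countBelow y [] = 0
countBelow y (z ∷ L) with z <? y
... | yes _ = suc (countBelow y L)
... | no  _ = countBelow y L

countBelow-mono : ∀ {a b} L → a ≤ b → countBelow a L ≤ countBelow b L
countBelow-mono [] _ = z≤n
countBelow-mono {a} {b} (z ∷ L) a≤b with z <? a | z <? b
... | yes _   | yes _   = s≤s (countBelow-mono L a≤b)
... | yes z<a | no  z≮b = ⊥-elim (z≮b (<-≤-trans z<a a≤b))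
... | no  _   | yes _   = m≤n⇒m≤1+n (countBelow-mono L a≤b)
... | no  _   | no  _   = countBelow-mono L a≤b

countBelow-mono-< : ∀ {a b} L → a ∈ L → a < b → countBelow a L < countBelow b L
countBelow-mono-< {a} {b} (z ∷ L) m a<b with z <? a | z <? b | m
... | yes z<a | _       | here refl = ⊥-elim (<-irrefl refl z<a)
... | no  _   | yes _   | here refl = s≤s (countBelow-mono L (<⇒≤ a<b))
... | no  _   | no  z≮b | here refl = ⊥-elim (z≮b a<b)
... | yes _   | yes _   | there m'  = s≤s (countBelow-mono-< L m' a<b)
... | yes z<a | no  z≮b | there _   = ⊥-elim (z≮b (<-trans z<a a<b))
... | no  _   | yes _   | there m'  = m<n⇒m<1+n (countBelow-mono-< L m' a<b)
... | no  _   | no  _   | there m'  = countBelow-mono-< L m' a<b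

countBelow-≤ : ∀ a L → countBelow a L ≤ length L
countBelow-≤ a [] = z≤n
countBelow-≤ a (z ∷ L) with z <? a
... | yes _ = s≤s (countBelow-≤ a L)
... | no  _ = m≤n⇒m≤1+n (countBelow-≤ a L)

countBelow-< : ∀ {a} L → a ∈ L → countBelow a L < length L
countBelow-< {a} (z ∷ L) m with z <? a | m
... | yes z<a | here refl = ⊥-elim (<-irrefl refl z<a)
... | no  _   | here refl = s≤s (countBelow-≤ a L)
... | yes _   | there m'  = s≤s (countBelow-< L m')
... | no  _   | there m'  = m<n⇒m<1+n (countBelow-< L m')

countBelow-0 : ∀ L → countBelow 0 L ≡ 0
countBelow-0 [] = refl
countBelow-0 (z ∷ L) with z <? 0
... | no _ = countBelow-0 L

-- 0 ↦ 0, xᵢ ↦ i and ∞ ↦ n + 1.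
index : List ℕ → V → ℕ
index X (fin y) = countBelow y (0 ∷ X)
index X ∞       = suc (length X)

index-mono : ∀ {X a b} → InHat X a → a <V b → index X a < index X b
index-mono {X} ha (fin<fin a<b) = countBelow-mono-< (0 ∷ X) (InHat-fin⇒∈ ha) a<b
index-mono {X} ha fin<∞         = countBelow-< (0 ∷ X) (InHat-fin⇒∈ ha)

index-≤ : ∀ X a → index X a ≤ suc (length X)
index-≤ X (fin y) = countBelow-≤ y (0 ∷ X)
index-≤ X ∞       = ≤-refl

index-0 : ∀ X → index X (fin 0) ≡ 0
index-0 X = countBelow-0 X

index-reflects-< : ∀ {X a b} → InHat X a → InHat X b → index X a < index X b → a <V b
index-reflects-< {X} {a} {b} ha hb lt with <V-cmp a b
... | tri< a<b _ _ = a<b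
... | tri≈ _ refl _ = ⊥-elim (<-irrefl refl lt)
... | tri> _ _ b<a = ⊥-elim (<-asym lt (index-mono hb b<a))

index-injective : ∀ {X a b} → InHat X a → InHat X b → index X a ≡ index X b → a ≡ b
index-injective {X} {a} {b} ha hb e with <V-cmp a b
... | tri< a<b _ _ = ⊥-elim (<-irrefl e (index-mono ha a<b))
... | tri≈ _ a≡b _ = a≡b
... | tri> _ _ b<a = ⊥-elim (<-irrefl (sym e) (index-mono hb b<a))

index-adjacent : ∀ {X a b} → InHat X a → index X b ≡ suc (index X a) → ¬ LetterBetween X a b
index-adjacent {X} {a} {b} ha e (y , m , ay , yb) =
  <⇒≱ (index-mono ha ay) (≤-pred (subst (index X (fin y) <_) e (index-mono (∈⇒InHat m) yb)))

Ear : List ℕ → List Seg → ℕ → Set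
Ear X T c = segAround c X ∈ T

outer-noncrossing : ∀ {a b y} → Within a b y → ¬ Crossing (a , b) y
outer-noncrossing ((_   , h≤b) , _) (inj₁ (_ , _ , b<h)) = <⇒≱ b<h h≤b
outer-noncrossing ((a≤g , _)   , _) (inj₂ (g<a , _ , _)) = <⇒≱ g<a a≤g

module Polygon {X T} (tri : IsTriangulation X T) where
  open IsTriangulation tri

  n : ℕ
  n = length X

  ι : Seg → Interval
  ι (a , b) = index X a , index X b

  -- The outer edge (0 , ∞) completes the n - 1 diagonals to a full family.
  polygon : List Interval
  polygon = (0 , suc n) ∷ map ι T

  ι-within : ∀ {d} → IsDiagonal X d → Within 0 (suc n) (ι d)
  ι-within {a , b} (ha , hb , ab , ¬edge) with nonEdge⇒letterBetween ha hb ab ¬edge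
  ... | y , m , ay , yb = (z≤n , index-≤ X b) , ≤-trans (s≤s (index-mono ha ay)) (index-mono (∈⇒InHat m) yb)

  ι-not-outer : ∀ {d} → IsDiagonal X d → ¬ (0 , suc n) ⊑ ι d
  ι-not-outer {a , b} (ha , hb , _ , ¬edge) (a≤0 , n<b) =
    ¬edge (inj₂ (index-injective ha InHat-0 (trans (n≤0⇒n≡0 a≤0) (sym (index-0 X))) ,
                 index-injective hb InHat-∞ (≤-antisym (index-≤ X b) n<b)))

  ι-injective : ∀ {d e} → IsDiagonal X d → IsDiagonal X e → ι d ≡ ι e → d ≡ e
  ι-injective (ha , hb , _) (hc , hd , _) e =
    cong₂ _,_ (index-injective ha hc (cong proj₁ e)) (index-injective hb hd (cong proj₂ e))

  ι-crossing : ∀ {d e} → IsDiagonal X d → IsDiagonal X e → Crossing (ι d) (ι e) → Cross d e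
  ι-crossing (ha , hb , _) (hc , hd , _) (inj₁ (ac , cb , bd)) =
    inj₁ (index-reflects-< ha hc ac , index-reflects-< hc hb cb , index-reflects-< hb hd bd)
  ι-crossing (ha , hb , _) (hc , hd , _) (inj₂ (ca , ad , db)) =
    inj₂ (index-reflects-< hc ha ca , index-reflects-< ha hd ad , index-reflects-< hd hb db)

  ι-unique : ∀ {S} → All (IsDiagonal X) S → Unique S → Unique (map ι S)
  ι-unique []         []           = []
  ι-unique {d ∷ _} (dg ∷ dgs) (d∉S ∷ uniq) = apart dgs d∉S ∷ ι-unique dgs uniq
    where
    apart : ∀ {S'} → All (IsDiagonal X) S' → All (d ≢_) S' → All (ι d ≢_) (map ι S')
    apart []           []           = []
    apart (dg' ∷ dgs') (d≢e ∷ d≢es) = (d≢e ∘ ι-injective dg dg') ∷ apart dgs' d≢es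

  polygon-family : 1 ≤ n → Family 0 (suc n) polygon
  polygon-family 1≤n = record
    { within      = tabulate within-polygon
    ; unique      = tabulate outer-∉ ∷ ι-unique diags distinct
    ; noncrossing = nc
    }
    where
    outer-within : Within 0 (suc n) (0 , suc n)
    outer-within = (≤-refl , ≤-refl) , s≤s 1≤n
    outer-∉ : ∀ {x} → x ∈ map ι T → (0 , suc n) ≢ x
    outer-∉ m e with ∈-map⁻ ι m
    ... | d , d∈T , refl = ι-not-outer (lookup diags d∈T) (subst ((0 , suc n) ⊑_) e (≤-refl , ≤-refl))
    within-polygon : ∀ {x} → x ∈ polygon → Within 0 (suc n) x
    within-polygon (here refl) = outer-within
    within-polygon (there m) with ∈-map⁻ ι m
    ... | d , d∈T , refl = ι-within (lookup diags d∈T)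
    nc : ∀ {x y} → x ∈ polygon → y ∈ polygon → ¬ Crossing x y
    nc (here refl) my          = outer-noncrossing (within-polygon my)
    nc mx          (here refl) = outer-noncrossing (within-polygon mx) ∘ Crossing-sym
    nc (there mx)  (there my) with ∈-map⁻ ι mx | ∈-map⁻ ι my
    ... | d , d∈T , refl | e , e∈T , refl =
      noncrossing d e d∈T e∈T ∘ ι-crossing (lookup diags d∈T) (lookup diags e∈T)

  polygon-full : 1 ≤ n → suc n ≤ suc (0 + length polygon)
  polygon-full 1≤n = s≤s (≤-reflexive (sym (begin
    length polygon          ≡⟨ cong suc (trans (length-map ι T) size) ⟩
    suc (n ∸ 1)             ≡⟨ m+[n∸m]≡n 1≤n ⟩
    n                       ∎)))
    where open ≡-Reasoning

  thin-diagonal-ear : ∀ {a b} → (a , b) ∈ T → index X b ≡ 2 + index X a →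
                     ∃ λ c → c ∈ X × Ear X T c × a <V fin c × fin c <V b
  thin-diagonal-ear {a} {b} ab∈T ib with lookup diags ab∈T
  ... | ha , hb , ab , ¬edge with nonEdge⇒letterBetween ha hb ab ¬edge
  ...   | c , c∈X , ac@(fin<fin a<c) , cb = c , c∈X , subst (_∈ T) (sym (cong₂ _,_ (cong fin pred≡) succ≡)) ab∈T , ac , cb
    where
    hc : InHat X (fin c)
    hc = ∈⇒InHat c∈X
    ic : index X (fin c) ≡ suc (index X a)
    ic = ≤-antisym (≤-pred (subst (index X (fin c) <_) ib (index-mono hc cb))) (index-mono ha ac)
    pred≡ : predIn c X ≡ _
    pred≡ = predIn-≡ X ha a<c (index-adjacent ha ic)
    succ≡ : succIn c X ≡ b
    succ≡ = succIn-≡ X hb cb (index-adjacent hc (trans ib (cong suc (sym ic))))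

  ear-inside : ∀ {p q} → (p , q) ∈ T → ∃ λ c → c ∈ X × Ear X T c × p <V fin c × fin c <V q
  ear-inside {p} {q} pq∈T with family-ear (polygon-family 1≤n) (polygon-full 1≤n) (there (∈-map⁺ ι pq∈T))
    where
    1≤n : 1 ≤ n
    1≤n with lookup diags pq∈T
    ... | hp , hq , pq , ¬edge = ∈⇒0<length (proj₁ (proj₂ (nonEdge⇒letterBetween hp hq pq ¬edge)))
  ... | i , here e  , ear⊑pq = ⊥-elim (ι-not-outer (lookup diags pq∈T) (subst (_⊑ ι (p , q)) e ear⊑pq))
  ... | i , there m , (a≤i , 2+i≤b) with ∈-map⁻ ι m
  ...   | (a , b) , ab∈T , e with thin-diagonal-ear ab∈T (trans (sym (cong proj₂ e)) (cong (2 +_) (cong proj₁ e)))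
  ...     | c , c∈X , ear , ac , cb with lookup diags pq∈T | lookup diags ab∈T
  ...       | hp , hq , _ | ha , _ = c , c∈X , ear , p<c , c<q
    where
    hc : InHat X (fin c)
    hc = ∈⇒InHat c∈X
    p<c : p <V fin c
    p<c = index-reflects-< hp hc (≤-<-trans (subst (index X p ≤_) (cong proj₁ e) a≤i) (index-mono ha ac))
    c<q : fin c <V q
    c<q = index-reflects-< hc hq (<-≤-trans (index-mono hc cb) (subst (_≤ index X q) (cong proj₂ e) 2+i≤b))

open Polygon using (ear-inside)

ear-exists : ∀ {X} T → IsTriangulation X T → 2 ≤ length X → ∃ λ c → c ∈ X × Ear X T c
ear-exists []      tri 2≤n = ⊥-elim (<-irrefl (IsTriangulation.size tri) (∸-monoˡ-≤ 1 2≤n))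
ear-exists (_ ∷ _) tri _   = let c , c∈X , ear , _ = ear-inside tri (here refl) in c , c∈X , ear

-- Readings

record Alphabet (X : List ℕ) : Set where
  field
    letters-unique   : Unique X
    letters-positive : All (0 <_) X

ValidX⇒Alphabet : ∀ {X} → ValidX X → Alphabet X
ValidX⇒Alphabet (sorted , positive) = record
  { letters-unique   = AllPairs.map (λ x<y x≡y → <-irrefl x≡y x<y) (Linked⇒AllPairs <-trans sorted)
  ; letters-positive = positive
  }

empty≈ₛ : ∀ {T} → length T ≡ 0 → [] ≈ₛ T
empty≈ₛ {[]} _ _ = mk⇔ (λ ()) (λ ())

module EarRemoval {X T} (α : Alphabet X) (tri : IsTriangulation X T) {c} (c∈X : c ∈ X) (ear : Ear X T c) where
  open IsTriangulation tri
  open Alphabet α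

  p s : V
  p = fin (predIn c X)
  s = succIn c X

  X⁻ : List ℕ
  X⁻ = delete _≟_ c X

  T⁻ : List Seg
  T⁻ = delete _≟S_ (p , s) T

  p<c : p <V fin c
  p<c = fin<fin (predIn-< X (lookup letters-positive c∈X))

  c<s : fin c <V s
  c<s = succIn-> c X

  consecutive-pc : Consecutive X p (fin c)
  consecutive-pc = consecutive-pred (lookup letters-positive c∈X) c∈X

  consecutive-cs : Consecutive X (fin c) s
  consecutive-cs = consecutive-succ c∈X

  only-c : ∀ {w} → InHat X w → p <V w → w <V s → w ≡ fin c
  only-c = between-consecutive consecutive-pc consecutive-cs

  InHat⁺ : ∀ {w} → InHat X⁻ w → InHat X w
  InHat⁺ = InHat-mono (delete-⊆ _≟_ X)

  InHat⁻ : ∀ {w} → InHat X w → w ≢ fin c → InHat X⁻ w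
  InHat⁻ (inj₁ refl)                  _   = InHat-0
  InHat⁻ (inj₂ (inj₁ refl))           _   = InHat-∞
  InHat⁻ (inj₂ (inj₂ (y , m , refl))) y≢c = ∈⇒InHat (∈-delete⁺ _≟_ m (y≢c ∘ cong fin))

  InHat⁻-≢ : ∀ {w} → InHat X⁻ w → w ≢ fin c
  InHat⁻-≢ (inj₁ refl)                  e = <-irrefl (fin-injective e) (lookup letters-positive c∈X)
  InHat⁻-≢ (inj₂ (inj₁ refl))           ()
  InHat⁻-≢ (inj₂ (inj₂ (y , m , refl))) e = delete-≢ _≟_ X m (fin-injective e)

  segAround-X⁻ : segAround c X⁻ ≡ (p , s)
  segAround-X⁻ = segAround-cong c X⁻ X (λ _ → delete-⊆ _≟_ X) (λ y≢c m → ∈-delete⁺ _≟_ m y≢c)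

  ¬endpoint : ∀ {a b} → (a , b) ∈ T → a ≢ fin c × b ≢ fin c
  ¬endpoint {a} {b} ab∈T with lookup diags ab∈T
  ... | ha , hb , ab , ¬edge = a≢c , b≢c
    where
    a≢c : a ≢ fin c
    a≢c refl with <V-cmp b s
    ... | tri< bs _ _ = <V⇒≢ ab (sym (only-c hb (<V-trans p<c ab) bs))
    ... | tri≈ _ refl _ = ¬edge (inj₁ consecutive-cs)
    ... | tri> _ _ sb = noncrossing (p , s) (a , b) ear ab∈T (inj₁ (p<c , c<s , sb))
    b≢c : b ≢ fin c
    b≢c refl with <V-cmp a p
    ... | tri< ap _ _ = noncrossing (a , b) (p , s) ab∈T ear (inj₁ (ap , p<c , c<s))
    ... | tri≈ _ refl _ = ¬edge (inj₁ consecutive-pc)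
    ... | tri> _ _ pa = <V⇒≢ ab (only-c ha pa (<V-trans ab c<s))

  diagonal⁻ : ∀ {d} → d ∈ T⁻ → IsDiagonal X⁻ d
  diagonal⁻ {a , b} m with lookup diags (delete-⊆ _≟S_ T m) | ¬endpoint (delete-⊆ _≟S_ T m)
  ... | ha , hb , ab , ¬edge | a≢c , b≢c = InHat⁻ ha a≢c , InHat⁻ hb b≢c , ab , ¬edge⁻
    where
    ¬edge⁻ : ¬ PolyEdge X⁻ a b
    ¬edge⁻ (inj₂ outer) = ¬edge (inj₂ outer)
    ¬edge⁻ (inj₁ cons) with nonEdge⇒letterBetween ha hb ab ¬edge
    ... | y , y∈X , ay , yb with y ≟ c
    ...   | yes refl = delete-≢ _≟S_ T m (trans (sym (segAround-≡ cons ay yb)) segAround-X⁻)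
    ...   | no  y≢c  = consecutive⇒¬between cons (y , ∈-delete⁺ _≟_ y∈X y≢c , ay , yb)

  length-X : length X ≡ suc (length X⁻)
  length-X = length-delete _≟_ X letters-unique c∈X

  length-T : length T ≡ suc (length T⁻)
  length-T = length-delete _≟S_ T distinct ear

  triangulation⁻ : IsTriangulation X⁻ T⁻
  triangulation⁻ = record
    { diags       = tabulate diagonal⁻
    ; distinct    = delete-unique _≟S_ T distinct
    ; size        = cong (_∸ 1) (trans (sym length-T) (trans size (cong (_∸ 1) length-X)))
    ; noncrossing = λ d e md me → noncrossing d e (delete-⊆ _≟S_ T md) (delete-⊆ _≟S_ T me)
    }

  alphabet⁻ : Alphabet X⁻
  alphabet⁻ = record
    { letters-unique   = delete-unique _≟_ X letters-unique
    ; letters-positive = tabulate (lookup letters-positive ∘ delete-⊆ _≟_ X)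
    }

  reading⁺ : ∀ {σ} → Reading X⁻ T⁻ σ → Reading X T (c ∷ σ)
  reading⁺ {[]} (perm , _) = ⊥-elim (<-irrefl (sym size⁰) (∈⇒0<length ear))
    where
    size⁰ : length T ≡ 0
    size⁰ = trans size (trans (cong (_∸ 1) length-X) (sym (↭-length perm)))
  reading⁺ {σ@(_ ∷ _)} (perm , φσ≈T⁻) =
    ↭-trans (↭-prep c perm) (↭-sym (delete-↭ _≟_ X letters-unique c∈X)) , φ≈T
    where
    head≡ : segAround c σ ≡ (p , s)
    head≡ = trans (segAround-cong c σ X⁻ (λ _ → ∈-resp-↭ perm) (λ _ → ∈-resp-↭ (↭-sym perm))) segAround-X⁻
    φ≈T : φ (c ∷ σ) ≈ₛ T
    φ≈T d = mk⇔ to from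
      where
      to : d ∈ φ (c ∷ σ) → d ∈ T
      to (here refl) = subst (_∈ T) (sym head≡) ear
      to (there m)   = delete-⊆ _≟S_ T (Equivalence.to (φσ≈T⁻ d) m)
      from : d ∈ T → d ∈ φ (c ∷ σ)
      from m with d ≟S (p , s)
      ... | yes refl = here (sym head≡)
      ... | no  d≢e  = there (Equivalence.from (φσ≈T⁻ d) (∈-delete⁺ _≟S_ m d≢e))

  side⁻ : ∀ {a b} → InHat X⁻ a → InHat X⁻ b → Side X T a b → Side X⁻ T⁻ a b
  side⁻ ha hb (inj₁ (inj₂ outer)) = inj₁ (inj₂ outer)
  side⁻ ha hb (inj₁ (inj₁ cons))  = inj₁ (inj₁ (Consecutive-⊆ (delete-⊆ _≟_ X) ha hb cons))
  side⁻ {a} {b} ha hb (inj₂ m) with (a , b) ≟S (p , s)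
  ... | yes refl = inj₁ (inj₁ (ha , hb , <V-trans p<c c<s , λ w hw pw ws → InHat⁻-≢ hw (only-c (InHat⁺ hw) pw ws)))
  ... | no  d≢e  = inj₂ (∈-delete⁺ _≟S_ m d≢e)

reading-exists : ∀ {X T} → Alphabet X → IsTriangulation X T → ∃ (Reading X T)
reading-exists = go (<-wellFounded _)
  where
  go : ∀ {X T} → Acc _<_ (length X) → Alphabet X → IsTriangulation X T → ∃ (Reading X T)
  go {[]}     _ _ tri = [] , ↭-refl , empty≈ₛ (IsTriangulation.size tri)
  go {x ∷ []} _ _ tri = x ∷ [] , ↭-refl , empty≈ₛ (IsTriangulation.size tri)
  go {_ ∷ _ ∷ _} {T} (acc rec) α tri with ear-exists T tri (s≤s (s≤s z≤n))
  ... | c , c∈X , ear = let σ , rd = go (rec (≤-reflexive (sym length-X))) alphabet⁻ triangulation⁻ in c ∷ σ , reading⁺ rd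
    where open EarRemoval α tri c∈X ear

reading-from : ∀ {X T c} → Alphabet X → IsTriangulation X T → c ∈ X → Side X T (fin (predIn c X)) (succIn c X) →
              ∃ λ v → Reading X T (c ∷ v)
reading-from α tri c∈X (inj₂ ear) =
  let σ , rd = reading-exists alphabet⁻ triangulation⁻ in σ , reading⁺ rd
  where open EarRemoval α tri c∈X ear
reading-from {X} {T} {c} α tri c∈X (inj₁ (inj₁ cons)) =
  ⊥-elim (consecutive⇒¬between cons (c , c∈X , fin<fin (predIn-< X (lookup letters-positive c∈X)) , succIn-> c X))
  where open Alphabet α
reading-from {X} {T} {c} α tri c∈X (inj₁ (inj₂ (p≡0 , s≡∞))) =
  [] , subst (c ∷ [] ↭_) (sym X≡c) ↭-refl , empty≈ₛ size⁰
  where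
  open Alphabet α
  only-c : ∀ {y} → y ∈ X → y ≡ c
  only-c {y} y∈X = fin-injective (between-consecutive
    (subst (λ p → Consecutive X p (fin c)) p≡0 (consecutive-pred (lookup letters-positive c∈X) c∈X))
    (subst (Consecutive X (fin c)) s≡∞ (consecutive-succ c∈X))
    (∈⇒InHat y∈X) (fin<fin (lookup letters-positive y∈X)) fin<∞)
  X≡c : X ≡ c ∷ []
  X≡c = unique-singleton letters-unique c∈X only-c
  size⁰ : length T ≡ 0
  size⁰ = trans (IsTriangulation.size tri) (cong (λ L → length L ∸ 1) X≡c)

-- Flips

module _ {T₁ T₂ A B : List Seg} {d d' : Seg} (≈T₁ : (A ++ d ∷ B) ≈ₛ T₁) (uniq : Unique (A ++ d ∷ B)) where

  private
    ∈-insert⁻ : ∀ {x e} → e ∈ A ++ x ∷ B → e ≡ x ⊎ e ∈ A ++ B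
    ∈-insert⁻ {x} m with ∈-resp-↭ (shift x A B) m
    ... | here e≡x = inj₁ e≡x
    ... | there m' = inj₂ m'

    ∈-insert⁺ : ∀ {x e} → e ∈ A ++ B → e ∈ A ++ x ∷ B
    ∈-insert⁺ {x} m = ∈-resp-↭ (↭-sym (shift x A B)) (there m)

    ≢d : ∀ {e} → e ∈ A ++ B → e ≢ d
    ≢d m refl with unique-resp-↭ (shift d A B) uniq
    ... | d∉A++B ∷ _ = All¬⇒¬Any d∉A++B m

    ∈T₁ : ∀ {e} → e ∈ A ++ B → e ∈ T₁
    ∈T₁ m = Equivalence.to (≈T₁ _) (∈-insert⁺ m)

  replace⇒≈ₛ : Replace T₁ T₂ d d' → (A ++ d' ∷ B) ≈ₛ T₂
  replace⇒≈ₛ (_ , rep) e = mk⇔ to from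
    where
    to : e ∈ A ++ d' ∷ B → e ∈ T₂
    to m with ∈-insert⁻ m
    ... | inj₁ refl = Equivalence.from (rep e) (inj₁ refl)
    ... | inj₂ m'   = Equivalence.from (rep e) (inj₂ (∈T₁ m' , ≢d m'))
    from : e ∈ T₂ → e ∈ A ++ d' ∷ B
    from m with Equivalence.to (rep e) m
    ... | inj₁ refl = ∈-insert A
    ... | inj₂ (m₁ , e≢d) with ∈-insert⁻ (Equivalence.from (≈T₁ e) m₁)
    ...   | inj₁ e≡d = ⊥-elim (e≢d e≡d)
    ...   | inj₂ m'  = ∈-insert⁺ m'

  ≈ₛ⇒replace : (A ++ d' ∷ B) ≈ₛ T₂ → Replace T₁ T₂ d d'
  ≈ₛ⇒replace ≈T₂ = Equivalence.to (≈T₁ d) (∈-insert A) , λ e → mk⇔ (to e) (from e)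
    where
    to : ∀ e → e ∈ T₂ → e ≡ d' ⊎ (e ∈ T₁ × e ≢ d)
    to e m with ∈-insert⁻ (Equivalence.from (≈T₂ e) m)
    ... | inj₁ e≡d' = inj₁ e≡d'
    ... | inj₂ m'   = inj₂ (∈T₁ m' , ≢d m')
    from : ∀ e → e ≡ d' ⊎ (e ∈ T₁ × e ≢ d) → e ∈ T₂
    from e (inj₁ refl) = Equivalence.to (≈T₂ e) (∈-insert A)
    from e (inj₂ (m₁ , e≢d)) with ∈-insert⁻ (Equivalence.from (≈T₁ e) m₁)
    ... | inj₁ e≡d = ⊥-elim (e≢d e≡d)
    ... | inj₂ m'  = Equivalence.to (≈T₂ e) (∈-insert⁺ m')

Replace-sym : ∀ {T₁ T₂ d d'} → d' ∉ T₁ → Replace T₁ T₂ d d' → Replace T₂ T₁ d' d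
Replace-sym {T₁} {T₂} {d} {d'} d'∉T₁ (d∈T₁ , rep) =
  Equivalence.from (rep d') (inj₁ refl) , λ e → mk⇔ (to e) (from e)
  where
  to : ∀ e → e ∈ T₁ → e ≡ d ⊎ (e ∈ T₂ × e ≢ d')
  to e m with e ≟S d
  ... | yes e≡d = inj₁ e≡d
  ... | no  e≢d = inj₂ (Equivalence.from (rep e) (inj₂ (m , e≢d)) , λ { refl → d'∉T₁ m })
  from : ∀ e → e ≡ d ⊎ (e ∈ T₂ × e ≢ d') → e ∈ T₁
  from e (inj₁ refl) = d∈T₁
  from e (inj₂ (m₂ , e≢d')) with Equivalence.to (rep e) m₂
  ... | inj₁ e≡d'     = ⊥-elim (e≢d' e≡d')
  ... | inj₂ (m₁ , _) = m₁

Side-replace : ∀ {X T₁ T₂ d d' a b} → Replace T₁ T₂ d d' → Side X T₁ a b → (a , b) ≢ d → Side X T₂ a b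
Side-replace _         (inj₁ edge) _    = inj₁ edge
Side-replace (_ , rep) (inj₂ m)    ab≢d = inj₂ (Equivalence.from (rep _) (inj₂ (m , ab≢d)))

Side-new : ∀ {X T₁ T₂ d a b} → Replace T₁ T₂ d (a , b) → Side X T₂ a b
Side-new (_ , rep) = inj₂ (Equivalence.from (rep _) (inj₁ refl))

-- The first alternative of DifferByFlip; the second one amounts to an oriented flip from T₂ to T₁.
OrientedFlip : List ℕ → List Seg → List Seg → Set
OrientedFlip X T₁ T₂ =
  Σ V λ p → Σ V λ q → Σ V λ r → Σ V λ s →
    InHat X p × InHat X q × InHat X r × InHat X s ×
    p <V q × q <V r × r <V s ×
    Face X T₁ p q r × Face X T₁ p r s × Replace T₁ T₂ (p , r) (q , s)

DifferByFlip⇒oriented : ∀ {X T₁ T₂} → IsTriangulation X T₁ → DifferByFlip X T₁ T₂ →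
                        OrientedFlip X T₁ T₂ ⊎ OrientedFlip X T₂ T₁
DifferByFlip⇒oriented _ (p , q , r , s , hp , hq , hr , hs , pq , qr , rs , inj₁ flip) =
  inj₁ (p , q , r , s , hp , hq , hr , hs , pq , qr , rs , flip)
DifferByFlip⇒oriented tri₁
  (p , q , r , s , hp , hq , hr , hs , pq , qr , rs , inj₂ ((spq , _ , sps) , (sqr , srs , _) , rep)) =
  inj₂ (p , q , r , s , hp , hq , hr , hs , pq , qr , rs ,
        (Side-replace rep spq (<V⇒≢ pq ∘ cong proj₁) , Side-replace rep sqr (<V⇒≢ rs ∘ cong proj₂) , Side-new rep) ,
        (Side-new rep , Side-replace rep srs (>V⇒≢ qr ∘ cong proj₁) , Side-replace rep sps (<V⇒≢ pq ∘ cong proj₁)) ,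
        Replace-sym (λ pr∈T₁ → IsTriangulation.noncrossing tri₁ _ _ pr∈T₁ (proj₁ rep) (inj₁ (pq , qr , rs))) rep)

oriented⇒DifferByFlip : ∀ {X T₁ T₂} → IsTriangulation X T₂ → OrientedFlip X T₁ T₂ ⊎ OrientedFlip X T₂ T₁ →
                        DifferByFlip X T₁ T₂
oriented⇒DifferByFlip _ (inj₁ (p , q , r , s , hp , hq , hr , hs , pq , qr , rs , flip)) =
  p , q , r , s , hp , hq , hr , hs , pq , qr , rs , inj₁ flip
oriented⇒DifferByFlip tri₂
  (inj₂ (p , q , r , s , hp , hq , hr , hs , pq , qr , rs , (spq , sqr , _) , (_ , srs , sps) , rep)) =
  p , q , r , s , hp , hq , hr , hs , pq , qr , rs ,
  inj₂ ((Side-replace rep spq (<V⇒≢ qr ∘ cong proj₂) , Side-new rep , Side-replace rep sps (>V⇒≢ rs ∘ cong proj₂)) ,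
        (Side-replace rep sqr (>V⇒≢ pq ∘ cong proj₁) , Side-replace rep srs (>V⇒≢ (<V-trans pq qr) ∘ cong proj₁) ,
         Side-new rep) ,
        Replace-sym (λ qs∈T₂ → IsTriangulation.noncrossing tri₂ _ _ (proj₁ rep) qs∈T₂ (inj₁ (pq , qr , rs))) rep)

AdjacentReadings : List ℕ → List Seg → List Seg → Set
AdjacentReadings X T₁ T₂ =
  Σ (List ℕ) λ w₁ → Σ (List ℕ) λ w₂ → Σ (List ℕ) λ u → Σ (List ℕ) λ v → Σ ℕ λ x → Σ ℕ λ z →
    Reading X T₁ w₁ × Reading X T₂ w₂ ×
    w₁ ≡ u ++ (x ∷ z ∷ v) × w₂ ≡ u ++ (z ∷ x ∷ v) ×
    All (λ y → ¬ Between x z y) v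

Between-sym : ∀ {x z y} → Between x z y → Between z x y
Between-sym (inj₁ xyz) = inj₂ xyz
Between-sym (inj₂ zyx) = inj₁ zyx

AdjacentReadings-sym : ∀ {X T₁ T₂} → AdjacentReadings X T₁ T₂ → AdjacentReadings X T₂ T₁
AdjacentReadings-sym (w₁ , w₂ , u , v , x , z , rd₁ , rd₂ , w₁≡ , w₂≡ , ¬between) =
  w₂ , w₁ , u , v , z , x , rd₂ , rd₁ , w₂≡ , w₁≡ , All.map (_∘ Between-sym) ¬between

Outside⇒¬Between : ∀ {a b y} → a < b → Outside a b y → ¬ Between a b y
Outside⇒¬Between _   (inj₁ y<a) (inj₁ (a<y , _))   = <-asym y<a a<y
Outside⇒¬Between _   (inj₂ b<y) (inj₁ (_ , y<b))   = <-asym b<y y<b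
Outside⇒¬Between a<b _          (inj₂ (b<y , y<a)) = <-asym a<b (<-trans b<y y<a)

¬Between⇒Outside : ∀ {a b v} → a ∉ v → b ∉ v → All (λ y → ¬ Between a b y) v → All (Outside a b) v
¬Between⇒Outside {a} {b} {v} a∉v b∉v ¬between = tabulate outside
  where
  outside : ∀ {y} → y ∈ v → Outside a b y
  outside {y} m with <-cmp y a | <-cmp y b
  ... | tri< y<a _ _ | _             = inj₁ y<a
  ... | tri≈ _ refl _ | _            = ⊥-elim (a∉v m)
  ... | tri> _ _ a<y | tri< y<b _ _  = ⊥-elim (lookup ¬between m (inj₁ (a<y , y<b)))
  ... | tri> _ _ _   | tri≈ _ refl _ = ⊥-elim (b∉v m)
  ... | tri> _ _ _   | tri> _ _ b<y  = inj₂ b<y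

ascent⇒OrientedFlip : ∀ {X T₁ T₂} u {x z v} → Alphabet X →
                      Reading X T₁ (u ++ x ∷ z ∷ v) → Reading X T₂ (u ++ z ∷ x ∷ v) →
                      x < z → All (λ y → ¬ Between x z y) v → OrientedFlip X T₁ T₂
ascent⇒OrientedFlip {X} {T₁} {T₂} u {x} {z} {v} α rd₁@(perm₁ , φ₁≈T₁) (_ , φ₂≈T₂) x<z ¬between =
  fin (predIn x v) , fin x , fin z , succIn z v ,
  InHat-mono (w⊆X ∘ there ∘ there) (predIn-InHat x v) , ∈⇒InHat (w⊆X (here refl)) ,
  ∈⇒InHat (w⊆X (there (here refl))) , InHat-mono (w⊆X ∘ there ∘ there) (succIn-InHat z v) ,
  fin<fin (predIn-< v 0<x) , fin<fin x<z , succIn-> z v ,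
  proj₁ faces , proj₂ faces ,
  ≈ₛ⇒replace (subst (_≈ₛ T₁) (φ-ascent u) φ₁≈T₁) (subst Unique (φ-ascent u) uniq)
             (subst (_≈ₛ T₂) (φ-descent u) φ₂≈T₂)
  where
  open Alphabet α
  uniqueWord : Unique (u ++ x ∷ z ∷ v)
  uniqueWord = unique-resp-↭ (↭-sym perm₁) letters-unique
  uniq : Unique (φ (u ++ x ∷ z ∷ v))
  uniq = φ-unique _ uniqueWord (All-resp-↭ (↭-sym perm₁) letters-positive)
  w⊆X : ∀ {y} → y ∈ x ∷ z ∷ v → y ∈ X
  w⊆X m = ∈-resp-↭ perm₁ (∈-++⁺ʳ u m)
  0<x : 0 < x
  0<x = lookup letters-positive (w⊆X (here refl))
  x∉v×z∉v : x ∉ v × z ∉ v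
  x∉v×z∉v = unique-∷∷ (unique-++⁻ʳ u uniqueWord)
  open AdjacentSwap x<z (¬Between⇒Outside (proj₁ x∉v×z∉v) (proj₂ x∉v×z∉v) ¬between)
  faces : Face X T₁ (fin (predIn x v)) (fin x) (fin z) × Face X T₁ (fin (predIn x v)) (fin z) (succIn z v)
  faces = ascent-faces u rd₁ 0<x

AdjacentReadings⇒oriented : ∀ {X T₁ T₂} → Alphabet X → AdjacentReadings X T₁ T₂ →
                            OrientedFlip X T₁ T₂ ⊎ OrientedFlip X T₂ T₁
AdjacentReadings⇒oriented α (_ , _ , u , v , x , z , rd₁ , rd₂ , refl , refl , ¬between) with <-cmp x z
... | tri< x<z _ _ = inj₁ (ascent⇒OrientedFlip u α rd₁ rd₂ x<z ¬between)
... | tri> _ _ z<x = inj₂ (ascent⇒OrientedFlip u α rd₂ rd₁ z<x (All.map (_∘ Between-sym) ¬between))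
... | tri≈ _ refl _ with unique-++⁻ʳ u (unique-resp-↭ (↭-sym (proj₁ rd₁)) (Alphabet.letters-unique α))
...   | (x≢x ∷ _) ∷ _ = ⊥-elim (x≢x refl)

side⇒diagonal : ∀ {X T a b} → Side X T a b → LetterBetween X a b → ¬ (a ≡ fin 0 × b ≡ ∞) → (a , b) ∈ T
side⇒diagonal (inj₁ edge) between outer = ⊥-elim (letterBetween⇒nonEdge between outer edge)
side⇒diagonal (inj₂ ab∈T) _       _     = ab∈T

record Reduction (X : List ℕ) (T : List Seg) (p q r s : V) : Set where
  field
    prefix         : List ℕ
    X*             : List ℕ
    T*             : List Seg
    alphabet*      : Alphabet X*
    triangulation* : IsTriangulation X* T*
    X*⊆X           : ∀ {y} → y ∈ X* → y ∈ X
    reading*⁺      : ∀ {σ} → Reading X* T* σ → Reading X T (prefix ++ σ)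
    side*          : ∀ {a b} → InHat X* a → InHat X* b → Side X T a b → Side X* T* a b
    consecutive-pq : Consecutive X* p q
    consecutive-qr : Consecutive X* q r
    consecutive-rs : Consecutive X* r s

ChainEar : List ℕ → List Seg → V → V → V → V → Set
ChainEar X T p q r s = ∃ λ c → c ∈ X × Ear X T c × p <V fin c × fin c <V s × fin c ≢ q × fin c ≢ r

chain-ear? : ∀ {X T p q r s} → IsTriangulation X T →
            InHat X p → InHat X q → InHat X r → InHat X s → p <V q → q <V r → r <V s →
            Side X T p q → Side X T q r → Side X T r s →
            (Consecutive X p q × Consecutive X q r × Consecutive X r s) ⊎ ChainEar X T p q r s
chain-ear? {X} {T} {p} {q} {r} {s} tri hp hq hr hs pq qr rs spq sqr srs
  with letterBetween? X p q | letterBetween? X q r | letterBetween? X r s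
... | no ¬pq | no ¬qr | no ¬rs = inj₁ (consecutive hp hq pq ¬pq , consecutive hq hr qr ¬qr , consecutive hr hs rs ¬rs)
... | yes between | _ | _ with ear-inside tri (side⇒diagonal spq between λ (_ , q≡∞) → ∞≮V (subst (_<V r) q≡∞ qr))
...   | c , c∈X , ear , pc , cq =
  inj₂ (c , c∈X , ear , pc , <V-trans cq (<V-trans qr rs) , <V⇒≢ cq , <V⇒≢ (<V-trans cq qr))
chain-ear? tri hp hq hr hs pq qr rs spq sqr srs | no _ | yes between | _
  with ear-inside tri (side⇒diagonal sqr between λ (q≡0 , _) → ≮V0 (subst (_ <V_) q≡0 pq))
...   | c , c∈X , ear , qc , cr =
  inj₂ (c , c∈X , ear , <V-trans pq qc , <V-trans cr rs , >V⇒≢ qc , <V⇒≢ cr)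
chain-ear? tri hp hq hr hs pq qr rs spq sqr srs | no _ | no _ | yes between
  with ear-inside tri (side⇒diagonal srs between λ (r≡0 , _) → ≮V0 (subst (_ <V_) r≡0 (<V-trans pq qr)))
...   | c , c∈X , ear , rc , cs =
  inj₂ (c , c∈X , ear , <V-trans (<V-trans pq qr) rc , cs , >V⇒≢ (<V-trans qr rc) , >V⇒≢ rc)

reduce : ∀ {X T p q r s} → Alphabet X → IsTriangulation X T →
         InHat X p → InHat X q → InHat X r → InHat X s → p <V q → q <V r → r <V s →
         Side X T p q → Side X T q r → Side X T r s → Reduction X T p q r s
reduce = go (<-wellFounded _)
  where
  go : ∀ {X T p q r s} → Acc _<_ (length X) → Alphabet X → IsTriangulation X T →
       InHat X p → InHat X q → InHat X r → InHat X s → p <V q → q <V r → r <V s →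
       Side X T p q → Side X T q r → Side X T r s → Reduction X T p q r s
  go {X} {T} {p} {q} {r} {s} (acc rec) α tri hp hq hr hs pq qr rs spq sqr srs with chain-ear? tri hp hq hr hs pq qr rs spq sqr srs
  ... | inj₁ (cpq , cqr , crs) = record
    { prefix = [] ; X* = X ; T* = T ; alphabet* = α ; triangulation* = tri ; X*⊆X = λ m → m
    ; reading*⁺ = λ rd → rd ; side* = λ _ _ side → side
    ; consecutive-pq = cpq ; consecutive-qr = cqr ; consecutive-rs = crs
    }
  ... | inj₂ (c , c∈X , ear , pc , cs , c≢q , c≢r) = record
    { prefix = c ∷ prefix ; X* = X* ; T* = T* ; alphabet* = alphabet* ; triangulation* = triangulation*
    ; X*⊆X = delete-⊆ _≟_ X ∘ X*⊆X
    ; reading*⁺ = reading⁺ ∘ reading*⁺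
    ; side* = λ ha hb → side* ha hb ∘ side⁻ (InHat-mono X*⊆X ha) (InHat-mono X*⊆X hb)
    ; consecutive-pq = consecutive-pq ; consecutive-qr = consecutive-qr ; consecutive-rs = consecutive-rs
    }
    where
    open EarRemoval α tri c∈X ear hiding (p; s)
    hp⁻ : InHat X⁻ p
    hp⁻ = InHat⁻ hp (<V⇒≢ pc)
    hq⁻ : InHat X⁻ q
    hq⁻ = InHat⁻ hq (c≢q ∘ sym)
    hr⁻ : InHat X⁻ r
    hr⁻ = InHat⁻ hr (c≢r ∘ sym)
    hs⁻ : InHat X⁻ s
    hs⁻ = InHat⁻ hs (>V⇒≢ cs)
    open Reduction (go (rec (≤-reflexive (sym length-X))) alphabet⁻ triangulation⁻ hp⁻ hq⁻ hr⁻ hs⁻ pq qr rs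
                       (side⁻ hp⁻ hq⁻ spq) (side⁻ hq⁻ hr⁻ sqr) (side⁻ hr⁻ hs⁻ srs))

quadrilateral-reading : ∀ {X T p q r s} → Alphabet X → IsTriangulation X T →
          Consecutive X p (fin q) → Consecutive X (fin q) (fin r) → Consecutive X (fin r) s →
          (p , fin r) ∈ T → Side X T p s → ∃ λ v → Reading X T (q ∷ r ∷ v)
quadrilateral-reading {X} {T} {p} {q} {r} {s} α tri cpq@(hp , hq , pq , _) cqr@(_ , hr , qr , _) crs@(_ , hs , rs , _) pr∈T sps =
  let v , rd = reading-from alphabet⁻ triangulation⁻ r∈X⁻ side-r in v , reading⁺ rd
  where
  q∈X : q ∈ X
  q∈X = InHat⇒∈ hq pq
  open EarRemoval α tri q∈X (subst (_∈ T) (sym (segAround-∈ cpq cqr)) pr∈T) hiding (p; s)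
  hp⁻ : InHat X⁻ p
  hp⁻ = InHat⁻ hp (<V⇒≢ pq)
  hr⁻ : InHat X⁻ (fin r)
  hr⁻ = InHat⁻ hr (>V⇒≢ qr)
  hs⁻ : InHat X⁻ s
  hs⁻ = InHat⁻ hs (>V⇒≢ (<V-trans qr rs))
  r∈X⁻ : r ∈ X⁻
  r∈X⁻ = InHat⇒∈ hr⁻ (<V-trans pq qr)
  cpr⁻ : Consecutive X⁻ p (fin r)
  cpr⁻ = consecutive hp⁻ hr⁻ (<V-trans pq qr) λ (y , m , py , yr) →
    delete-≢ _≟_ X m (fin-injective (between-consecutive cpq cqr (∈⇒InHat (delete-⊆ _≟_ X m)) py yr))
  side-r : Side X⁻ T⁻ (fin (predIn r X⁻)) (succIn r X⁻)
  side-r = subst (λ (a , b) → Side X⁻ T⁻ a b) (sym (segAround-∈ cpr⁻ (Consecutive-⊆ (delete-⊆ _≟_ X) hr⁻ hs⁻ crs)))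
                 (side⁻ hp⁻ hs⁻ sps)

module AdjacentLetters {X p q r s v} (uniq : Unique X) (perm : q ∷ r ∷ v ↭ X)
  (cpq : Consecutive X (fin p) (fin q)) (cqr : Consecutive X (fin q) (fin r)) (crs : Consecutive X (fin r) s) where

  private
    p<q : p < q
    p<q = fin<fin⁻ (proj₁ (proj₂ (proj₂ cpq)))

    q<r : q < r
    q<r = fin<fin⁻ (proj₁ (proj₂ (proj₂ cqr)))

    r<s : fin r <V s
    r<s = proj₁ (proj₂ (proj₂ crs))

    q∉v×r∉v : q ∉ v × r ∉ v
    q∉v×r∉v = unique-∷∷ (unique-resp-↭ (↭-sym perm) uniq)

    InHat-v : ∀ {w} → InHat X w → w ≢ fin q → w ≢ fin r → InHat v w
    InHat-v (inj₁ refl)                  _ _ = InHat-0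
    InHat-v (inj₂ (inj₁ refl))           _ _ = InHat-∞
    InHat-v (inj₂ (inj₂ (y , m , refl))) y≢q y≢r with ∈-resp-↭ (↭-sym perm) m
    ... | here refl         = ⊥-elim (y≢q refl)
    ... | there (here refl) = ⊥-elim (y≢r refl)
    ... | there (there m')  = ∈⇒InHat m'

    gap : ∀ {a b} → Consecutive X a b → ¬ LetterBetween v a b
    gap cons (y , m , ay , yb) = consecutive⇒¬between cons (y , ∈-resp-↭ perm (there (there m)) , ay , yb)

  predIn-q : predIn q v ≡ p
  predIn-q = predIn-≡ v (InHat-v (proj₁ cpq) (<V⇒≢ (fin<fin p<q)) (<V⇒≢ (fin<fin (<-trans p<q q<r)))) p<q (gap cpq)

  succIn-r : succIn r v ≡ s
  succIn-r = succIn-≡ v (InHat-v (proj₁ (proj₂ crs)) (>V⇒≢ (<V-trans (fin<fin q<r) r<s)) (>V⇒≢ r<s))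
                      r<s (gap crs)

  outside : All (Outside q r) v
  outside = tabulate outside-v
    where
    outside-v : ∀ {y} → y ∈ v → Outside q r y
    outside-v {y} m with <-cmp y q | <-cmp y r
    ... | tri< y<q _ _ | _             = inj₁ y<q
    ... | tri≈ _ refl _ | _            = ⊥-elim (proj₁ q∉v×r∉v m)
    ... | tri> _ _ q<y | tri< y<r _ _  = ⊥-elim (gap cqr (y , m , fin<fin q<y , fin<fin y<r))
    ... | tri> _ _ _   | tri≈ _ refl _ = ⊥-elim (proj₂ q∉v×r∉v m)
    ... | tri> _ _ _   | tri> _ _ r<y  = inj₂ r<y

OrientedFlip⇒AdjacentReadings : ∀ {X T₁ T₂} → Alphabet X → IsTriangulation X T₁ → OrientedFlip X T₁ T₂ →
                                AdjacentReadings X T₁ T₂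
OrientedFlip⇒AdjacentReadings {X} {T₁} {T₂} α tri
  (_ , _ , _ , s , hp , hq , hr , hs , pq@(fin<fin {p} {q} _) , qr@(fin<fin {_} {r} q<r) , rs ,
   (spq , sqr , spr) , (_ , srs , sps) , rep) =
  prefix ++ q ∷ r ∷ v , prefix ++ r ∷ q ∷ v , prefix , v , q , r , rd₁ , (perm₂ , φ₂≈T₂) , refl , refl ,
  All.map (Outside⇒¬Between q<r) outside
  where
  open Alphabet α
  open Reduction (reduce α tri hp hq hr hs pq qr rs spq sqr srs)
  pr∈T* : (fin p , fin r) ∈ T*
  pr∈T* = side⇒diagonal (side* (proj₁ consecutive-pq) (proj₁ consecutive-rs) spr)
                        (q , InHat⇒∈ (proj₁ consecutive-qr) pq , pq , qr) (λ { (_ , ()) })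
  reading* : ∃ λ v → Reading X* T* (q ∷ r ∷ v)
  reading* = quadrilateral-reading alphabet* triangulation* consecutive-pq consecutive-qr consecutive-rs pr∈T*
                                   (side* (proj₁ consecutive-pq) (proj₁ (proj₂ consecutive-rs)) sps)
  v : List ℕ
  v = proj₁ reading*
  open AdjacentLetters (Alphabet.letters-unique alphabet*) (proj₁ (proj₂ reading*)) consecutive-pq consecutive-qr consecutive-rs
  open AdjacentSwap q<r outside
  rd₁ : Reading X T₁ (prefix ++ q ∷ r ∷ v)
  rd₁ = reading*⁺ (proj₂ reading*)
  A B : List Seg
  A = φPrefix prefix (q ∷ r ∷ v)
  B = φ (r ∷ v)
  φ₁≡ : φ (prefix ++ q ∷ r ∷ v) ≡ A ++ (fin p , fin r) ∷ B
  φ₁≡ = trans (φ-ascent prefix) (cong (λ a → A ++ (fin a , fin r) ∷ B) predIn-q)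
  φ₂≡ : φ (prefix ++ r ∷ q ∷ v) ≡ A ++ (fin q , s) ∷ B
  φ₂≡ = trans (φ-descent prefix) (cong (λ b → A ++ (fin q , b) ∷ B) succIn-r)
  uniq : Unique (φ (prefix ++ q ∷ r ∷ v))
  uniq = φ-unique _ (unique-resp-↭ (↭-sym (proj₁ rd₁)) letters-unique) (All-resp-↭ (↭-sym (proj₁ rd₁)) letters-positive)
  φ₂≈T₂ : φ (prefix ++ r ∷ q ∷ v) ≈ₛ T₂
  φ₂≈T₂ = subst (_≈ₛ T₂) (sym φ₂≡)
                (replace⇒≈ₛ (subst (_≈ₛ T₁) φ₁≡ (proj₂ rd₁)) (subst Unique φ₁≡ uniq) rep)
  perm₂ : prefix ++ r ∷ q ∷ v ↭ X
  perm₂ = ↭-trans (++⁺ˡ prefix (↭-swap r q ↭-refl)) (proj₁ rd₁)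

mainTheorem8 : (X : List ℕ) → ValidX X →
    (T₁ T₂ : List Seg) → IsTriangulation X T₁ → IsTriangulation X T₂ →
    DifferByFlip X T₁ T₂ ⇔
      (Σ (List ℕ) λ w₁ → Σ (List ℕ) λ w₂ → Σ (List ℕ) λ u → Σ (List ℕ) λ v →
       Σ ℕ λ x → Σ ℕ λ z →
         Reading X T₁ w₁ × Reading X T₂ w₂ ×
         w₁ ≡ u ++ (x ∷ z ∷ v) × w₂ ≡ u ++ (z ∷ x ∷ v) ×
         All (λ y → ¬ Between x z y) v)
mainTheorem8 X valid T₁ T₂ tri₁ tri₂ = mk⇔
  (λ flip → [ OrientedFlip⇒AdjacentReadings α tri₁ , AdjacentReadings-sym ∘ OrientedFlip⇒AdjacentReadings α tri₂ ]′
              (DifferByFlip⇒oriented tri₁ flip))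
  (λ readings → oriented⇒DifferByFlip tri₂ (AdjacentReadings⇒oriented α readings))
  where
  α : Alphabet X
  α = ValidX⇒Alphabet valid
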